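{- Let $C_n$ be the cycle graph on $n\ge3$ vertices. The number $N(C_n)$ of directed graphs $D$ whose underlying graph is $C_n$, counted up to isomorphism of unlabeled digraphs, is $$N(C_n)=\begin{cases}\frac{1}{2n}\sum_{d\mid n}2^{n/d}\varphi(d), & n\ge3\text{ odd},\\ \frac{1}{2n}\sum_{d\mid n}2^{n/d}\varphi(d)+2^{\frac n2-2}, & n\ge4\text{ even},\end{cases}$$ where $\varphi$ is Euler's totient function.
   Context: Two digraphs are isomorphic if there is a bijection between their vertex sets preserving arrows (in both directions). The underlying graph of a digraph is obtained by forgetting the orientation of its arrows. -}

module Defs where

open import Data.Nat using (ℕ; zero; suc; _+_; _*_; _^_; _/_; _≟_)
open import Data.Nat.GCD using (gcd)
open import Data.Nat.Divisibility using (_∣?_)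
open import Data.List using (List; length; filter; map; upTo)
open import Data.Nat.ListAction using (sum)
open import Data.Fin using (Fin; toℕ)
open import Data.Bool using (Bool; true)
open import Data.Product using (_×_; Σ)
open import Data.Sum using (_⊎_)
open import Relation.Binary.PropositionalEquality using (_≡_)
open import Relation.Nullary using (¬_)
open import Function.Bundles using (_↔_; Inverse)

range1 : ℕ → List ℕ
range1 n = map suc (upTo n)

totient : ℕ → ℕ
totient d = length (filter (λ k → gcd k d ≟ 1) (range1 d))

necklaceSum : (n : ℕ) → ℕ
necklaceSum n = sum (map (λ k → 2 ^ (n / suc k) * totient (suc k))
                         (filter (λ k → suc k ∣? n) (upTo n)))
-- (d = suc k runs over 1..n, restricted to divisors of n)

Succ : (n : ℕ) → Fin n → Fin n → Set
Succ n i j = (suc (toℕ i) ≡ toℕ j) ⊎ ((suc (toℕ i) ≡ n) × (toℕ j ≡ 0))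

CycleAdj : (n : ℕ) → Fin n → Fin n → Set
CycleAdj n i j = Succ n i j ⊎ Succ n j i

-- A digraph on Fin n: D i j ≡ true means there is an arrow i → j
Digraph : ℕ → Set
Digraph n = Fin n → Fin n → Bool

Oriented : {n : ℕ} → Digraph n → Set
Oriented {n} D = (i j : Fin n) → ¬ ((D i j ≡ true) × (D j i ≡ true))

UnderlyingIsCycle : (n : ℕ) → Digraph n → Set
UnderlyingIsCycle n D =
  (i j : Fin n) → ((D i j ≡ true ⊎ D j i ≡ true) → CycleAdj n i j)
                × (CycleAdj n i j → (D i j ≡ true ⊎ D j i ≡ true))

CycleDigraph : ℕ → Set
CycleDigraph n = Σ (Digraph n) (λ D → Oriented D × UnderlyingIsCycle n D)

_≅_ : {n : ℕ} → Digraph n → Digraph n → Set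
_≅_ {n} D E = Σ (Fin n ↔ Fin n) (λ σ → (i j : Fin n) → D i j ≡ E (Inverse.to σ i) (Inverse.to σ j))

-- N(C_n) = c : there is a list of c digraphs with underlying graph C_n which are
-- pairwise non-isomorphic and such that every such digraph is isomorphic to one of them.
NumIsoClasses : (n : ℕ) → ℕ → Set
NumIsoClasses n c =
  Σ (Fin c → CycleDigraph n) (λ R →
      ((a b : Fin c) → Data.Product.proj₁ (R a) ≅ Data.Product.proj₁ (R b) → a ≡ b)
    × ((D : CycleDigraph n) → Σ (Fin c) (λ a → Data.Product.proj₁ D ≅ Data.Product.proj₁ (R a))))

{-# OPTIONS --safe #-}
-- Orient every edge {i, i + 1} of C_n by one bit: the digraphs with underlying graph C_n are
-- exactly the words w ∈ {0,1}^n, and since every automorphism of C_n (n ≥ 3) is a rotation or a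
-- reflection, two of them are isomorphic iff their words lie in one orbit of the dihedral group
-- D_n acting by relabelling vertices. Hence N(C_n) is the number of orbits, and Burnside's lemma
-- gives 2n · N(C_n) = Σ_g |Fix g|. A rotation by a fixes the 2^gcd(a,n) words of period
-- gcd(a,n), and Σ_a 2^gcd(a,n) = Σ_{d ∣ n} 2^(n/d) φ(d) with Euler's φ. A reflection that maps
-- some edge onto itself reverses it and so fixes no word; this covers all reflections for odd n
-- and half of them for even n. The other n/2 reflections are conjugate to x ↦ −x, whose fixed
-- words are determined by their first n/2 letters, contributing (n/2) · 2^(n/2) = 2n · 2^(n/2 − 2).

module Submission where

open import Data.Nat
  using (ℕ; zero; suc; pred; _+_; _*_; _^_; _∸_; _/_; _%_; _<_; _≤_; _<?_; z≤n; s≤s;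
         NonZero; ≢-nonZero; ≢-nonZero⁻¹)
import Data.Nat.Properties as ℕ
open import Data.Nat.Properties
  using (+-comm; +-assoc; +-suc; +-identityʳ; *-comm; *-identityʳ; *-zeroʳ; *-cancelˡ-≡; *-monoʳ-<;
         <⇒≤; ≤⇒≯; ≮⇒≥; ≤-refl; ≤-reflexive; ≤-trans; ≤-antisym; <-irrefl; <-≤-trans; ≤-<-trans;
         ∸-monoʳ-<; ∸-monoʳ-≤; n∸n≡0; pred[m∸n]≡m∸[1+n]; m∸[m∸n]≡n; m+n∸n≡m; m+[n∸m]≡n; m≤m+n;
         +-*-semiring)
open import Data.Nat.DivMod
  using (_mod_; m%n<n; m%n%n≡m%n; %-distribˡ-+; m<n⇒m%n≡m; n%n≡0; [m+n]%n≡m%n; m≡m%n+[m/n]*n;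
         m∣n⇒o%n%m≡o%m; m*[n/m]≡n; m*n/n≡m; m<n*o⇒m/o<n)
open import Data.Nat.Divisibility using (_∣_; _∣?_; divides; ∣-antisym; ∣-refl; ∣⇒≤)
open import Data.Nat.GCD
  using (gcd; gcd-GCD; module Bézout; c*gcd[m,n]≡gcd[cm,cn]; gcd[m,n]∣m; gcd[m,n]∣n; gcd[m,n]≢0;
         gcd-greatest)
import Data.Nat.ListAction as ListAction
open import Data.Nat.Tactic.RingSolver using (solve-∀)
open import Data.Fin as Fin using (Fin; toℕ; fromℕ<; fromℕ; inject₁)
open import Data.Fin.Properties
  using (1↔⊤; 2↔Bool; +↔⊎; *↔×; cantor-schröder-bernstein; toℕ-fromℕ<; toℕ-injective; toℕ<n;
         toℕ-fromℕ; toℕ-inject₁; fromℕ<-cong; fromℕ<-toℕ; suc-injective)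
open import Data.Bool using (Bool; true; false; not; _∧_; _∨_; _xor_; if_then_else_)
open import Data.Bool.Properties using (∨-identityʳ; ¬-not; not-¬; not-involutive; xor-assoc; xor-identityʳ)
open import Data.Empty using (⊥; ⊥-elim)
open import Data.Sum using (_⊎_; inj₁; inj₂; swap)
import Data.Sum
open import Data.Sum.Function.Propositional using (_⊎-↔_)
open import Data.Product using (Σ; _×_; _,_; proj₁; proj₂)
open import Data.Product.Function.NonDependent.Propositional using (_×-↔_)
open import Data.Product.Function.Dependent.Propositional using (Σ-↔)
open import Data.List using (List; length; filter; map; applyUpTo; upTo)
import Data.List as List
open import Data.List.Membership.Propositional using (_∈_)
open import Data.List.Membership.Propositional.Properties using (∈-tabulate⁺)
import Data.List.Relation.Unary.All as All
open import Data.List.Extrema.Nat using (argmin; f[argmin]≤f[xs])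
open import Data.Vec using (Vec; []; _∷_; lookup; tabulate)
open import Data.Vec.Properties using (lookup∘tabulate; tabulate∘lookup; tabulate-cong)
open import Data.Vec.Relation.Binary.Pointwise.Extensional using (ext; Pointwise-≡⇒≡)
open import Function using (_∘_; id)
open import Function.Bundles using (_↔_; Inverse; Injection; mk↔ₛ′)
open import Function.Definitions using (Injective)
open import Function.Properties.Inverse using (↔-refl; ↔-sym; ↔-trans; ↔⇒↣)
open import Function.Related.TypeIsomorphisms using (∃∃↔∃∃; Σ-assoc)
open import Level using (0ℓ)
open import Algebra.Core using (Op₁; Op₂)
open import Algebra.Structures using (IsGroup; IsAbelianGroup)
open import Algebra.Bundles using (Group; AbelianGroup)
import Algebra.Properties.Group as GroupProperties
import Algebra.Properties.AbelianGroup as AbelianGroupProperties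
open import Algebra.Properties.Semiring.Sum +-*-semiring
  using (sum; sum-syntax; sum-init-last; sum-cong-≗; sum-replicate-zero; *-distribˡ-sum; ∑-comm)
open import Axiom.UniquenessOfIdentityProofs using (UIP; module Decidable⇒UIP)
open import Relation.Nullary using (¬_; Dec; yes; no; does; Irrelevant)
open import Relation.Nullary.Decidable using (map′)
open import Relation.Unary using (Pred; Decidable)
open import Relation.Binary.Definitions using (DecidableEquality)
open import Relation.Binary.PropositionalEquality
  using (_≡_; _≢_; refl; sym; trans; cong; cong₂; subst; subst₂; module ≡-Reasoning)
open import Relation.Binary.PropositionalEquality.Algebra using (isMagma)
open import Defs

open ≡-Reasoning

-- Finite cardinalities

indicator : {P : Set} → Dec P → ℕ
indicator P? = if does P? then 1 else 0

indicator-yes : {P : Set} (P? : Dec P) → P → indicator P? ≡ 1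
indicator-yes (yes _) _ = refl
indicator-yes (no ¬p) p = ⊥-elim (¬p p)

indicator-no : {P : Set} (P? : Dec P) → ¬ P → indicator P? ≡ 0
indicator-no (yes p) ¬p = ⊥-elim (¬p p)
indicator-no (no _)  _  = refl

↔Fin-injective : {A : Set} {m k : ℕ} → A ↔ Fin m → A ↔ Fin k → m ≡ k
↔Fin-injective e e′ = cantor-schröder-bernstein
  (Injection.injective (↔⇒↣ (↔-trans (↔-sym e) e′)))
  (Injection.injective (↔⇒↣ (↔-trans (↔-sym e′) e)))

Σ-Fin-↔-sum : {n : ℕ} {B : Fin n → Set} (f : Fin n → ℕ) →
              (∀ i → B i ↔ Fin (f i)) → Σ (Fin n) B ↔ Fin (sum f)
Σ-Fin-↔-sum {zero} f e = mk↔ₛ′ proj₁ (λ ()) (λ ()) (λ { (() , _) })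
Σ-Fin-↔-sum {suc n} {B} f e =
  ↔-trans split (↔-trans (e Fin.zero ⊎-↔ Σ-Fin-↔-sum (λ i → f (Fin.suc i)) (λ i → e (Fin.suc i))) (↔-sym +↔⊎))
  where
  split : Σ (Fin (suc n)) B ↔ (B Fin.zero ⊎ Σ (Fin n) (λ i → B (Fin.suc i)))
  split = mk↔ₛ′ (λ { (Fin.zero , b) → inj₁ b ; (Fin.suc i , b) → inj₂ (i , b) })
                (λ { (inj₁ b) → Fin.zero , b ; (inj₂ (i , b)) → Fin.suc i , b })
                (λ { (inj₁ b) → refl ; (inj₂ (i , b)) → refl })
                (λ { (Fin.zero , b) → refl ; (Fin.suc i , b) → refl })

Dec-↔-Fin : {P : Set} → Irrelevant P → (P? : Dec P) → P ↔ Fin (indicator P?)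
Dec-↔-Fin irr (yes p) = ↔-trans (mk↔ₛ′ _ (λ _ → p) (λ _ → refl) (irr p)) (↔-sym 1↔⊤)
Dec-↔-Fin irr (no ¬p) = mk↔ₛ′ (λ p → ⊥-elim (¬p p)) (λ ()) (λ ()) (λ p → ⊥-elim (¬p p))

Vec-↔-Fin-^ : {A : Set} {k : ℕ} → A ↔ Fin k → (m : ℕ) → Vec A m ↔ Fin (k ^ m)
Vec-↔-Fin-^ e zero =
  mk↔ₛ′ (λ _ → Fin.zero) (λ _ → []) (λ { Fin.zero → refl ; (Fin.suc ()) }) (λ { [] → refl })
Vec-↔-Fin-^ e (suc m) = ↔-trans uncons (↔-trans (e ×-↔ Vec-↔-Fin-^ e m) (↔-sym *↔×))
  where
  uncons : Vec _ (suc m) ↔ (_ × Vec _ m)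
  uncons = mk↔ₛ′ (λ { (x ∷ xs) → x , xs }) (λ (x , xs) → x ∷ xs) (λ _ → refl) (λ { (x ∷ xs) → refl })

Σ-≡-irrelevant : {A : Set} {P : A → Set} → (∀ {x} → Irrelevant (P x)) →
                 {x y : A} {p : P x} {q : P y} → x ≡ y → (x , p) ≡ (y , q)
Σ-≡-irrelevant irr refl = cong (_ ,_) (irr _ _)

Σ-↔-restrict : {A B : Set} {P : A → Set} {Q : B → Set} →
               (∀ {x} → Irrelevant (P x)) → (∀ {y} → Irrelevant (Q y)) →
               (f : A → B) (g : B → A) →
               (∀ {x} → P x → Q (f x)) → (∀ {y} → Q y → P (g y)) →
               (∀ {x} → P x → g (f x) ≡ x) → (∀ {y} → Q y → f (g y) ≡ y) →
               Σ A P ↔ Σ B Q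
Σ-↔-restrict irrP irrQ f g pf qg gf fg =
  mk↔ₛ′ (λ (x , p) → f x , pf p) (λ (y , q) → g y , qg q)
        (λ (y , q) → Σ-≡-irrelevant irrQ (fg q)) (λ (x , p) → Σ-≡-irrelevant irrP (gf p))

Σ-Dec-↔-Fin : {X : Set} {m : ℕ} {P : X → Set} (e : X ↔ Fin m) →
              (∀ {x} → Irrelevant (P x)) → (P? : ∀ x → Dec (P x)) →
              Σ X P ↔ Fin (sum (λ i → indicator (P? (Inverse.from e i))))
Σ-Dec-↔-Fin e irr P? =
  ↔-trans (↔-sym (Σ-↔ (↔-sym e) ↔-refl)) (Σ-Fin-↔-sum _ (λ i → Dec-↔-Fin irr (P? (Inverse.from e i))))

Σ-↔-retract : {A B : Set} {P : A → Set} → (∀ {x} → Irrelevant (P x)) →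
              (f : A → B) (g : B → A) → (∀ y → P (g y)) →
              (∀ {x} → P x → g (f x) ≡ x) → (∀ y → f (g y) ≡ y) → Σ A P ↔ B
Σ-↔-retract irr f g Pg gf fg =
  mk↔ₛ′ (λ (x , _) → f x) (λ y → g y , Pg y) fg (λ (x , p) → Σ-≡-irrelevant irr (gf p))

module Burnside
  {G X : Set} {_·_ : Op₂ G} {ε : G} {_⁻¹ : Op₁ G} (isGroup : IsGroup _≡_ _·_ ε _⁻¹)
  (act : G → X → X)
  (act-ε : ∀ x → act ε x ≡ x)
  (act-· : ∀ g h x → act (g · h) x ≡ act g (act h x))
  (elements : List G) (∈-elements : ∀ g → g ∈ elements)
  (key : X → ℕ) (key-injective : Injective _≡_ _≡_ key)
  where

  group : Group 0ℓ 0ℓ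
  group = record { isGroup = isGroup }

  open GroupProperties group
    using (\\-leftDividesˡ; \\-leftDividesʳ)
  open IsGroup isGroup using (inverseˡ; inverseʳ)

  act-inverseˡ : ∀ g x → act (g ⁻¹) (act g x) ≡ x
  act-inverseˡ g x = trans (sym (act-· (g ⁻¹) g x)) (trans (cong (λ h → act h x) (inverseˡ g)) (act-ε x))

  act-inverseʳ : ∀ g x → act g (act (g ⁻¹) x) ≡ x
  act-inverseʳ g x = trans (sym (act-· g (g ⁻¹) x)) (trans (cong (λ h → act h x) (inverseʳ g)) (act-ε x))

  act-↔ : G → X ↔ X
  act-↔ g = mk↔ₛ′ (act g) (act (g ⁻¹)) (act-inverseʳ g) (act-inverseˡ g)

  _≟_ : DecidableEquality X
  x ≟ y = map′ key-injective (cong key) (key x ℕ.≟ key y)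

  ≡-irrelevant : UIP X
  ≡-irrelevant = Decidable⇒UIP.≡-irrelevant _≟_

  transporter : X → G
  transporter x = argmin (λ g → key (act g x)) ε elements

  canon : X → X
  canon x = act (transporter x) x

  canon-minimal : ∀ g x → key (canon x) ≤ key (act g x)
  canon-minimal g x = All.lookup (f[argmin]≤f[xs] ε elements) (∈-elements g)

  -- Both sides are the key-minimal element of the orbit of x.
  canon-act : ∀ g x → canon (act g x) ≡ canon x
  canon-act g x = key-injective (≤-antisym
    (subst (λ y → key (canon (act g x)) ≤ key y)
           (trans (act-· _ _ (act g x)) (cong (act m) (act-inverseˡ g x)))
           (canon-minimal (m · (g ⁻¹)) (act g x)))
    (subst (λ y → key (canon x) ≤ key y) (act-· _ g x) (canon-minimal (transporter (act g x) · g) x)))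
    where
    m = transporter x

  Canonical : X → Set
  Canonical x = canon x ≡ x

  canon-canonical : ∀ x → Canonical (canon x)
  canon-canonical x = canon-act (transporter x) x

  canonical-unique : ∀ {x y} g → Canonical x → Canonical y → y ≡ act g x → x ≡ y
  canonical-unique {x} {y} g cx cy y≡gx = begin
    x               ≡⟨ cx ⟨
    canon x         ≡⟨ canon-act g x ⟨
    canon (act g x) ≡⟨ cong canon y≡gx ⟨
    canon y         ≡⟨ cy ⟩
    y               ∎

  Fix : G → Set
  Fix g = Σ X (λ x → act g x ≡ x)

  stabilizer↔transporters : ∀ x → Σ G (λ g → act g x ≡ x) ↔ Σ G (λ h → Canonical (act h x))
  stabilizer↔transporters x =
    Σ-↔-restrict ≡-irrelevant ≡-irrelevant (m ·_) ((m ⁻¹) ·_) fixed⇒canonical canonical⇒fixed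
      (λ {g} _ → \\-leftDividesʳ m g) (λ {h} _ → \\-leftDividesˡ m h)
    where
    m = transporter x
    fixed⇒canonical : ∀ {g} → act g x ≡ x → Canonical (act (m · g) x)
    fixed⇒canonical {g} gx≡x = subst Canonical (sym m·g-x) (canon-canonical x)
      where
      m·g-x : act (m · g) x ≡ canon x
      m·g-x = trans (act-· m g x) (cong (act m) gx≡x)
    canonical⇒fixed : ∀ {h} → Canonical (act h x) → act ((m ⁻¹) · h) x ≡ x
    canonical⇒fixed {h} c = begin
      act ((m ⁻¹) · h) x          ≡⟨ act-· (m ⁻¹) h x ⟩
      act (m ⁻¹) (act h x)      ≡⟨ cong (act (m ⁻¹)) c ⟨
      act (m ⁻¹) (canon (act h x)) ≡⟨ cong (act (m ⁻¹)) (canon-act h x) ⟩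
      act (m ⁻¹) (act m x)      ≡⟨ act-inverseˡ m x ⟩
      x                         ∎

  -- Σ_g |Fix g| = Σ_x |Stab x| = Σ_x |{h ∣ h x canonical}| = Σ_h |{x ∣ h x canonical}| = |G| · #canonical
  burnside-↔ : Σ G Fix ↔ (G × Σ X Canonical)
  burnside-↔ =
    ↔-trans (∃∃↔∃∃ (λ g x → act g x ≡ x))
    (↔-trans (Σ-↔ ↔-refl (stabilizer↔transporters _))
    (↔-trans (∃∃↔∃∃ (λ x h → Canonical (act h x)))
             (Σ-↔ ↔-refl (Σ-↔ (act-↔ _) ↔-refl))))

  burnside : ∀ {|G| c N} → G ↔ Fin |G| → Σ X Canonical ↔ Fin c → Σ G Fix ↔ Fin N → |G| * c ≡ N
  burnside eG eC eF = ↔Fin-injective (↔-trans (eG ×-↔ eC) (↔-sym *↔×)) (↔-trans (↔-sym burnside-↔) eF)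

  Fix-conjugate : ∀ g h → Fix ((h · g) · (h ⁻¹)) ↔ Fix g
  Fix-conjugate g h = Σ-↔-restrict ≡-irrelevant ≡-irrelevant (act (h ⁻¹)) (act h) forth back
    (λ {x} _ → act-inverseʳ h x) (λ {y} _ → act-inverseˡ h y)
    where
    act-conjugate : ∀ x → act ((h · g) · (h ⁻¹)) x ≡ act h (act g (act (h ⁻¹) x))
    act-conjugate x = trans (act-· (h · g) (h ⁻¹) x) (act-· h g _)
    forth : ∀ {x} → act ((h · g) · (h ⁻¹)) x ≡ x → act g (act (h ⁻¹) x) ≡ act (h ⁻¹) x
    forth {x} fixed = begin
      act g (act (h ⁻¹) x)                     ≡⟨ act-inverseˡ h _ ⟨
      act (h ⁻¹) (act h (act g (act (h ⁻¹) x))) ≡⟨ cong (act (h ⁻¹)) (act-conjugate x) ⟨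
      act (h ⁻¹) (act ((h · g) · (h ⁻¹)) x)     ≡⟨ cong (act (h ⁻¹)) fixed ⟩
      act (h ⁻¹) x                             ∎
    back : ∀ {y} → act g y ≡ y → act ((h · g) · (h ⁻¹)) (act h y) ≡ act h y
    back {y} fixed = begin
      act ((h · g) · (h ⁻¹)) (act h y)         ≡⟨ act-conjugate (act h y) ⟩
      act h (act g (act (h ⁻¹) (act h y)))     ≡⟨ cong (λ z → act h (act g z)) (act-inverseˡ h y) ⟩
      act h (act g y)                          ≡⟨ cong (act h) fixed ⟩
      act h y                                  ∎

-- Sums over ℕ

even-or-odd : ∀ x → Σ ℕ (λ t → x ≡ t + t) ⊎ Σ ℕ (λ t → x ≡ suc (t + t))
even-or-odd zero = inj₁ (0 , refl)
even-or-odd (suc zero) = inj₂ (0 , refl)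
even-or-odd (suc (suc x)) with even-or-odd x
... | inj₁ (t , x≡t+t)   = inj₁ (suc t , cong suc (trans (cong suc x≡t+t) (sym (+-suc t t))))
... | inj₂ (t , x≡1+t+t) = inj₂ (suc t , cong suc (trans (cong suc x≡1+t+t) (cong suc (sym (+-suc t t)))))

m*2≡m+m : ∀ m → m * 2 ≡ m + m
m*2≡m+m = solve-∀

onEven : ℕ → ℕ → ℕ
onEven c zero          = c
onEven c (suc zero)    = 0
onEven c (suc (suc x)) = onEven c x

onEven-even : ∀ c t → onEven c (t + t) ≡ c
onEven-even c zero    = refl
onEven-even c (suc t) = trans (cong (λ x → onEven c (suc x)) (+-suc t t)) (onEven-even c t)

onEven-odd : ∀ c t → onEven c (suc (t + t)) ≡ 0
onEven-odd c zero    = refl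
onEven-odd c (suc t) = trans (cong (λ x → onEven c (suc (suc x))) (+-suc t t)) (onEven-odd c t)

sum-onEven : ∀ c m → sum {m * 2} (λ i → onEven c (toℕ i)) ≡ m * c
sum-onEven c zero    = refl
sum-onEven c (suc m) = cong (c +_) (sum-onEven c m)

sum-map-filter-applyUpTo : {P : Pred ℕ 0ℓ} (P? : Decidable P) (g h : ℕ → ℕ) (n : ℕ) →
  ListAction.sum (map g (filter P? (applyUpTo h n)))
    ≡ ∑[ k < n ] (if does (P? (h (toℕ k))) then g (h (toℕ k)) else 0)
sum-map-filter-applyUpTo P? g h zero = refl
sum-map-filter-applyUpTo P? g h (suc n) with does (P? (h 0))
... | true  = cong (g (h 0) +_) (sum-map-filter-applyUpTo P? g (h ∘ suc) n)
... | false = sum-map-filter-applyUpTo P? g (h ∘ suc) n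

length-filter-map-applyUpTo : {P : Pred ℕ 0ℓ} (P? : Decidable P) (f h : ℕ → ℕ) (n : ℕ) →
  length (filter P? (map f (applyUpTo h n))) ≡ ∑[ k < n ] indicator (P? (f (h (toℕ k))))
length-filter-map-applyUpTo P? f h zero = refl
length-filter-map-applyUpTo P? f h (suc n) with does (P? (f (h 0)))
... | true  = cong suc (length-filter-map-applyUpTo P? f (h ∘ suc) n)
... | false = length-filter-map-applyUpTo P? f (h ∘ suc) n

sum-vanishing-outside : ∀ {n} (f : Fin n → ℕ) i → (∀ j → j ≢ i → f j ≡ 0) → sum f ≡ f i
sum-vanishing-outside {suc n} f Fin.zero vanish = begin
  f Fin.zero + sum (f ∘ Fin.suc)    ≡⟨ cong (f Fin.zero +_) (sum-cong-≗ {n} λ j → vanish (Fin.suc j) λ ()) ⟩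
  f Fin.zero + sum {n} (λ _ → 0)    ≡⟨ cong (f Fin.zero +_) (sum-replicate-zero n) ⟩
  f Fin.zero + 0                    ≡⟨ +-identityʳ (f Fin.zero) ⟩
  f Fin.zero                        ∎
sum-vanishing-outside {suc n} f (Fin.suc i) vanish = begin
  f Fin.zero + sum (f ∘ Fin.suc)    ≡⟨ cong (_+ sum (f ∘ Fin.suc)) (vanish Fin.zero (λ ())) ⟩
  sum (f ∘ Fin.suc)                 ≡⟨ sum-vanishing-outside (f ∘ Fin.suc) i
                                         (λ j j≢i → vanish (Fin.suc j) (j≢i ∘ suc-injective)) ⟩
  f (Fin.suc i)                     ∎

module Cyclic (n : ℕ) ⦃ _ : NonZero n ⦄ where

  [_] : ℕ → Fin n
  [ x ] = x mod n

  toℕ-[] : ∀ x → toℕ [ x ] ≡ x % n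
  toℕ-[] x = toℕ-fromℕ< (m%n<n x n)

  []-cong-% : ∀ {x y} → x % n ≡ y % n → [ x ] ≡ [ y ]
  []-cong-% {x} {y} eq = toℕ-injective (trans (toℕ-[] x) (trans eq (sym (toℕ-[] y))))

  [toℕ] : ∀ a → [ toℕ a ] ≡ a
  [toℕ] a = toℕ-injective (trans (toℕ-[] (toℕ a)) (m<n⇒m%n≡m (toℕ<n a)))

  [%+] : ∀ x y → [ x % n + y ] ≡ [ x + y ]
  [%+] x y = []-cong-% (begin
    (x % n + y) % n         ≡⟨ %-distribˡ-+ (x % n) y n ⟩
    (x % n % n + y % n) % n ≡⟨ cong (λ z → (z + y % n) % n) (m%n%n≡m%n x n) ⟩
    (x % n + y % n) % n     ≡⟨ %-distribˡ-+ x y n ⟨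
    (x + y) % n             ∎)

  infixl 6 _⊕_
  _⊕_ : Fin n → Fin n → Fin n
  a ⊕ b = [ toℕ a + toℕ b ]

  ⊖_ : Fin n → Fin n
  ⊖ a = [ n ∸ toℕ a ]

  𝟘 𝟙 : Fin n
  𝟘 = [ 0 ]
  𝟙 = [ 1 ]

  [n]≡𝟘 : [ n ] ≡ 𝟘
  [n]≡𝟘 = []-cong-% ([m+n]%n≡m%n 0 n)

  []-⊕-homo : ∀ x y → [ x ] ⊕ [ y ] ≡ [ x + y ]
  []-⊕-homo x y = begin
    [ toℕ [ x ] + toℕ [ y ] ] ≡⟨ cong₂ (λ u v → [ u + v ]) (toℕ-[] x) (toℕ-[] y) ⟩
    [ x % n + y % n ]         ≡⟨ [%+] x (y % n) ⟩
    [ x + y % n ]             ≡⟨ cong [_] (+-comm x (y % n)) ⟩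
    [ y % n + x ]             ≡⟨ [%+] y x ⟩
    [ y + x ]                 ≡⟨ cong [_] (+-comm y x) ⟩
    [ x + y ]                 ∎

  []-suc : ∀ k → [ k ] ⊕ 𝟙 ≡ [ suc k ]
  []-suc k = trans ([]-⊕-homo k 1) (cong [_] (+-comm k 1))

  ⊕-comm : ∀ a b → a ⊕ b ≡ b ⊕ a
  ⊕-comm a b = cong [_] (+-comm (toℕ a) (toℕ b))

  ⊕-assoc : ∀ a b c → (a ⊕ b) ⊕ c ≡ a ⊕ (b ⊕ c)
  ⊕-assoc a b c = begin
    [ toℕ a + toℕ b ] ⊕ c             ≡⟨ cong ([ toℕ a + toℕ b ] ⊕_) ([toℕ] c) ⟨
    [ toℕ a + toℕ b ] ⊕ [ toℕ c ]     ≡⟨ []-⊕-homo _ (toℕ c) ⟩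
    [ toℕ a + toℕ b + toℕ c ]         ≡⟨ cong [_] (+-assoc (toℕ a) (toℕ b) (toℕ c)) ⟩
    [ toℕ a + (toℕ b + toℕ c) ]       ≡⟨ []-⊕-homo (toℕ a) _ ⟨
    [ toℕ a ] ⊕ [ toℕ b + toℕ c ]     ≡⟨ cong (_⊕ [ toℕ b + toℕ c ]) ([toℕ] a) ⟩
    a ⊕ (b ⊕ c)                       ∎

  ⊕-identityʳ : ∀ a → a ⊕ 𝟘 ≡ a
  ⊕-identityʳ a = begin
    a ⊕ 𝟘             ≡⟨ cong (_⊕ 𝟘) ([toℕ] a) ⟨
    [ toℕ a ] ⊕ [ 0 ] ≡⟨ []-⊕-homo (toℕ a) 0 ⟩
    [ toℕ a + 0 ]     ≡⟨ cong [_] (+-identityʳ (toℕ a)) ⟩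
    [ toℕ a ]         ≡⟨ [toℕ] a ⟩
    a                 ∎

  ⊕-identityˡ : ∀ a → 𝟘 ⊕ a ≡ a
  ⊕-identityˡ a = trans (⊕-comm 𝟘 a) (⊕-identityʳ a)

  ⊖-inverseʳ : ∀ a → a ⊕ ⊖ a ≡ 𝟘
  ⊖-inverseʳ a = begin
    a ⊕ ⊖ a                     ≡⟨ cong (_⊕ ⊖ a) ([toℕ] a) ⟨
    [ toℕ a ] ⊕ [ n ∸ toℕ a ]   ≡⟨ []-⊕-homo (toℕ a) _ ⟩
    [ toℕ a + (n ∸ toℕ a) ]     ≡⟨ cong [_] (m+[n∸m]≡n (<⇒≤ (toℕ<n a))) ⟩
    [ n ]                       ≡⟨ [n]≡𝟘 ⟩
    𝟘                           ∎

  ⊖-inverseˡ : ∀ a → ⊖ a ⊕ a ≡ 𝟘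
  ⊖-inverseˡ a = trans (⊕-comm (⊖ a) a) (⊖-inverseʳ a)

  ⊕-isAbelianGroup : IsAbelianGroup _≡_ _⊕_ 𝟘 ⊖_
  ⊕-isAbelianGroup = record
    { isGroup = record
      { isMonoid = record
        { isSemigroup = record { isMagma = isMagma _⊕_ ; assoc = ⊕-assoc }
        ; identity = ⊕-identityˡ , ⊕-identityʳ
        }
      ; inverse = ⊖-inverseˡ , ⊖-inverseʳ
      ; ⁻¹-cong = cong ⊖_
      }
    ; comm = ⊕-comm
    }

  ⊕-abelianGroup : AbelianGroup 0ℓ 0ℓ
  ⊕-abelianGroup = record { isAbelianGroup = ⊕-isAbelianGroup }

module Periodic {A : Set} (n : ℕ) ⦃ _ : NonZero n ⦄ where
  open Cyclic n

  _!_ : Vec A n → ℕ → A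
  w ! x = lookup w [ x ]

  HasPeriod : Vec A n → ℕ → Set
  HasPeriod w t = ∀ x → w ! (x + t) ≡ w ! x

  n-period : ∀ w → HasPeriod w n
  n-period w x = cong (lookup w) ([]-cong-% ([m+n]%n≡m%n x n))

  *-period : ∀ w t → HasPeriod w t → ∀ k → HasPeriod w (k * t)
  *-period w t p zero    x = cong (w !_) (+-identityʳ x)
  *-period w t p (suc k) x = begin
    w ! (x + (t + k * t))  ≡⟨ cong (w !_) (+-assoc x t (k * t)) ⟨
    w ! (x + t + k * t)    ≡⟨ *-period w t p k (x + t) ⟩
    w ! (x + t)            ≡⟨ p x ⟩
    w ! x                  ∎

  ∣-period : ∀ w {d t} → HasPeriod w d → d ∣ t → HasPeriod w t
  ∣-period w {d} p (divides k refl) = *-period w d p k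

  gcd-period : ∀ w t → HasPeriod w t → HasPeriod w (gcd t n)
  gcd-period w t p with Bézout.identity (gcd-GCD t n)
  ... | Bézout.+- x y d+yn≡xt = λ z → begin
    w ! (z + gcd t n)                ≡⟨ *-period w n (n-period w) y (z + gcd t n) ⟨
    w ! (z + gcd t n + y * n)        ≡⟨ cong (w !_) (trans (+-assoc z _ _) (cong (z +_) d+yn≡xt)) ⟩
    w ! (z + x * t)                  ≡⟨ *-period w t p x z ⟩
    w ! z                            ∎
  ... | Bézout.-+ x y d+xt≡yn = λ z → sym (begin
    w ! z                            ≡⟨ *-period w n (n-period w) y z ⟨
    w ! (z + y * n)                  ≡⟨ cong (w !_) (trans (+-assoc z _ _) (cong (z +_) d+xt≡yn)) ⟨
    w ! (z + gcd t n + x * t)        ≡⟨ *-period w t p x (z + gcd t n) ⟩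
    w ! (z + gcd t n)                ∎)

  module _ {d : ℕ} ⦃ _ : NonZero d ⦄ (d∣n : d ∣ n) where

    restrict : Vec A n → Vec A d
    restrict w = tabulate (λ j → w ! toℕ j)

    extend : Vec A d → Vec A n
    extend v = tabulate (λ k → lookup v (toℕ k mod d))

    extend-! : ∀ v x → extend v ! x ≡ lookup v (x mod d)
    extend-! v x = trans (lookup∘tabulate _ [ x ]) (cong (lookup v) (toℕ-injective (begin
      toℕ (toℕ [ x ] mod d) ≡⟨ toℕ-fromℕ< _ ⟩
      toℕ [ x ] % d         ≡⟨ cong (_% d) (toℕ-[] x) ⟩
      x % n % d             ≡⟨ m∣n⇒o%n%m≡o%m d n x d∣n ⟩
      x % d                 ≡⟨ toℕ-fromℕ< _ ⟨
      toℕ (x mod d)         ∎)))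

    extend-period : ∀ v → HasPeriod (extend v) d
    extend-period v x = begin
      extend v ! (x + d)            ≡⟨ extend-! v (x + d) ⟩
      lookup v ((x + d) mod d)      ≡⟨ cong (lookup v) (toℕ-injective (trans (toℕ-fromℕ< _)
                                         (trans ([m+n]%n≡m%n x d) (sym (toℕ-fromℕ< _))))) ⟩
      lookup v (x mod d)            ≡⟨ extend-! v x ⟨
      extend v ! x                  ∎

    restrict-extend : ∀ v → restrict (extend v) ≡ v
    restrict-extend v = trans (tabulate-cong λ j → trans (extend-! v (toℕ j))
      (cong (lookup v) (toℕ-injective (trans (toℕ-fromℕ< _) (m<n⇒m%n≡m (toℕ<n j))))))
      (tabulate∘lookup v)

    extend-restrict : ∀ w → HasPeriod w d → extend (restrict w) ≡ w
    extend-restrict w p = Pointwise-≡⇒≡ (ext λ k → begin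
      lookup (extend (restrict w)) k   ≡⟨ lookup∘tabulate _ k ⟩
      lookup (restrict w) (toℕ k mod d) ≡⟨ lookup∘tabulate (λ j → w ! toℕ j) _ ⟩
      w ! toℕ (toℕ k mod d)             ≡⟨ cong (w !_) (toℕ-fromℕ< _) ⟩
      w ! (toℕ k % d)                   ≡⟨ *-period w d p (toℕ k / d) _ ⟨
      w ! (toℕ k % d + toℕ k / d * d)   ≡⟨ cong (w !_) (m≡m%n+[m/n]*n (toℕ k) d) ⟨
      w ! toℕ k                         ≡⟨ cong (lookup w) ([toℕ] k) ⟩
      lookup w k                        ∎)

module Dihedral (n : ℕ) ⦃ _ : NonZero n ⦄ where
  open Cyclic n
  open AbelianGroupProperties ⊕-abelianGroup
    using (⁻¹-involutive; ⁻¹-∙-comm; ε⁻¹≈ε)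

  ⊖^_ : Bool → Fin n → Fin n
  (⊖^ false) a = a
  (⊖^ true)  a = ⊖ a

  ⊖^-⊕ : ∀ s a b → (⊖^ s) (a ⊕ b) ≡ (⊖^ s) a ⊕ (⊖^ s) b
  ⊖^-⊕ false a b = refl
  ⊖^-⊕ true  a b = sym (⁻¹-∙-comm a b)

  ⊖^-xor : ∀ s t a → (⊖^ s) ((⊖^ t) a) ≡ (⊖^ (s xor t)) a
  ⊖^-xor false t     a = refl
  ⊖^-xor true  false a = refl
  ⊖^-xor true  true  a = ⁻¹-involutive a

  ⊖^-𝟘 : ∀ s → (⊖^ s) 𝟘 ≡ 𝟘
  ⊖^-𝟘 false = refl
  ⊖^-𝟘 true  = ε⁻¹≈ε

  -- (false , a) is the rotation x ↦ x + a of C_n and (true , a) the reflection x ↦ a − x.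
  D : Set
  D = Bool × Fin n

  φ : D → Fin n → Fin n
  φ (s , a) x = (⊖^ s) x ⊕ a

  infixl 7 _·_
  _·_ : D → D → D
  (s , a) · (t , b) = s xor t , a ⊕ (⊖^ s) b

  ε : D
  ε = false , 𝟘

  _⁻¹ : D → D
  (false , a) ⁻¹ = false , ⊖ a
  (true  , a) ⁻¹ = true , a

  ·-assoc : ∀ g h k → (g · h) · k ≡ g · (h · k)
  ·-assoc (s , a) (t , b) (u , c) = cong₂ _,_ (xor-assoc s t u) (begin
    a ⊕ (⊖^ s) b ⊕ (⊖^ (s xor t)) c       ≡⟨ cong (a ⊕ (⊖^ s) b ⊕_) (⊖^-xor s t c) ⟨
    a ⊕ (⊖^ s) b ⊕ (⊖^ s) ((⊖^ t) c)      ≡⟨ ⊕-assoc a _ _ ⟩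
    a ⊕ ((⊖^ s) b ⊕ (⊖^ s) ((⊖^ t) c))    ≡⟨ cong (a ⊕_) (⊖^-⊕ s b _) ⟨
    a ⊕ (⊖^ s) (b ⊕ (⊖^ t) c)             ∎)

  ·-inverseˡ : ∀ g → g ⁻¹ · g ≡ ε
  ·-inverseˡ (false , a) = cong (false ,_) (⊖-inverseˡ a)
  ·-inverseˡ (true  , a) = cong (false ,_) (⊖-inverseʳ a)

  ·-inverseʳ : ∀ g → g · g ⁻¹ ≡ ε
  ·-inverseʳ (false , a) = cong (false ,_) (⊖-inverseʳ a)
  ·-inverseʳ (true  , a) = cong (false ,_) (⊖-inverseʳ a)

  ·-isGroup : IsGroup _≡_ _·_ ε _⁻¹
  ·-isGroup = record
    { isMonoid = record
      { isSemigroup = record { isMagma = isMagma _·_ ; assoc = ·-assoc }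
      ; identity = (λ (s , a) → cong (s ,_) (⊕-identityˡ a))
                 , (λ (s , a) → cong₂ _,_ (xor-identityʳ s)
                                          (trans (cong (a ⊕_) (⊖^-𝟘 s)) (⊕-identityʳ a)))
      }
    ; inverse = ·-inverseˡ , ·-inverseʳ
    ; ⁻¹-cong = cong _⁻¹
    }

  ·-group : Group 0ℓ 0ℓ
  ·-group = record { isGroup = ·-isGroup }

  φ-· : ∀ g h x → φ (g · h) x ≡ φ g (φ h x)
  φ-· (s , a) (t , b) x = begin
    (⊖^ (s xor t)) x ⊕ (a ⊕ (⊖^ s) b)       ≡⟨ cong (_⊕ (a ⊕ (⊖^ s) b)) (⊖^-xor s t x) ⟨
    (⊖^ s) ((⊖^ t) x) ⊕ (a ⊕ (⊖^ s) b)      ≡⟨ cong ((⊖^ s) ((⊖^ t) x) ⊕_) (⊕-comm a _) ⟩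
    (⊖^ s) ((⊖^ t) x) ⊕ ((⊖^ s) b ⊕ a)      ≡⟨ ⊕-assoc _ _ a ⟨
    (⊖^ s) ((⊖^ t) x) ⊕ (⊖^ s) b ⊕ a        ≡⟨ cong (_⊕ a) (⊖^-⊕ s _ b) ⟨
    (⊖^ s) ((⊖^ t) x ⊕ b) ⊕ a               ∎

  φ-ε : ∀ x → φ ε x ≡ x
  φ-ε = ⊕-identityʳ

module CycleDigraphs (n : ℕ) ⦃ _ : NonZero n ⦄ (3≤n : 3 ≤ n) where
  open Cyclic n
  open AbelianGroupProperties ⊕-abelianGroup using (∙-cancelˡ)

  [k]≢𝟘 : ∀ {k} → 0 < k → k < n → [ k ] ≢ 𝟘
  [k]≢𝟘 {k} 0<k k<n [k]≡𝟘 = <-irrefl (sym k≡0) 0<k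
    where
    k≡0 : k ≡ 0
    k≡0 = begin
      k           ≡⟨ m<n⇒m%n≡m k<n ⟨
      k % n       ≡⟨ toℕ-[] k ⟨
      toℕ [ k ]   ≡⟨ cong toℕ [k]≡𝟘 ⟩
      toℕ [ 0 ]   ≡⟨ toℕ-[] 0 ⟩
      0 % n       ≡⟨ m<n⇒m%n≡m (<-≤-trans (s≤s z≤n) 3≤n) ⟩
      0           ∎

  x⊕[k]≢x : ∀ {k} x → 0 < k → k < n → x ⊕ [ k ] ≢ x
  x⊕[k]≢x x 0<k k<n eq = [k]≢𝟘 0<k k<n (∙-cancelˡ x _ _ (trans eq (sym (⊕-identityʳ x))))

  x⊕𝟙⊕𝟙≢x : ∀ x → x ⊕ 𝟙 ⊕ 𝟙 ≢ x
  x⊕𝟙⊕𝟙≢x x eq = x⊕[k]≢x x (s≤s z≤n) 3≤n (begin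
    x ⊕ [ 2 ]      ≡⟨ cong (x ⊕_) ([]-⊕-homo 1 1) ⟨
    x ⊕ (𝟙 ⊕ 𝟙)    ≡⟨ ⊕-assoc x 𝟙 𝟙 ⟨
    x ⊕ 𝟙 ⊕ 𝟙      ≡⟨ eq ⟩
    x              ∎)

  toℕ-⊕𝟙 : ∀ i → toℕ (i ⊕ 𝟙) ≡ suc (toℕ i) % n
  toℕ-⊕𝟙 i = begin
    toℕ (i ⊕ 𝟙)               ≡⟨ cong (λ a → toℕ (a ⊕ 𝟙)) ([toℕ] i) ⟨
    toℕ ([ toℕ i ] ⊕ [ 1 ])   ≡⟨ cong toℕ ([]-⊕-homo (toℕ i) 1) ⟩
    toℕ [ toℕ i + 1 ]         ≡⟨ toℕ-[] _ ⟩
    (toℕ i + 1) % n           ≡⟨ cong (_% n) (+-comm (toℕ i) 1) ⟩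
    suc (toℕ i) % n           ∎

  Succ⇒≡⊕𝟙 : ∀ {i j} → Succ n i j → j ≡ i ⊕ 𝟙
  Succ⇒≡⊕𝟙 {i} {j} (inj₁ si≡j) = toℕ-injective (begin
    toℕ j            ≡⟨ m<n⇒m%n≡m (toℕ<n j) ⟨
    toℕ j % n        ≡⟨ cong (_% n) si≡j ⟨
    suc (toℕ i) % n  ≡⟨ toℕ-⊕𝟙 i ⟨
    toℕ (i ⊕ 𝟙)      ∎)
  Succ⇒≡⊕𝟙 {i} {j} (inj₂ (si≡n , j≡0)) = toℕ-injective (begin
    toℕ j            ≡⟨ j≡0 ⟩
    0                ≡⟨ n%n≡0 n ⟨
    n % n            ≡⟨ cong (_% n) si≡n ⟨
    suc (toℕ i) % n  ≡⟨ toℕ-⊕𝟙 i ⟨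
    toℕ (i ⊕ 𝟙)      ∎)

  ≡⊕𝟙⇒Succ : ∀ {i j} → j ≡ i ⊕ 𝟙 → Succ n i j
  ≡⊕𝟙⇒Succ {i} refl with suc (toℕ i) <? n
  ... | yes si<n = inj₁ (sym (trans (toℕ-⊕𝟙 i) (m<n⇒m%n≡m si<n)))
  ... | no  si≮n = inj₂ (si≡n , trans (toℕ-⊕𝟙 i) (trans (cong (_% n) si≡n) (n%n≡0 n)))
    where
    si≡n : suc (toℕ i) ≡ n
    si≡n = ≤-antisym (toℕ<n i) (≮⇒≥ si≮n)

  Adj : Fin n → Fin n → Set
  Adj i j = j ≡ i ⊕ 𝟙 ⊎ i ≡ j ⊕ 𝟙

  CycleAdj⇒Adj : ∀ {i j} → CycleAdj n i j → Adj i j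
  CycleAdj⇒Adj (inj₁ s) = inj₁ (Succ⇒≡⊕𝟙 s)
  CycleAdj⇒Adj (inj₂ s) = inj₂ (Succ⇒≡⊕𝟙 s)

  Adj⇒CycleAdj : ∀ {i j} → Adj i j → CycleAdj n i j
  Adj⇒CycleAdj (inj₁ e) = inj₁ (≡⊕𝟙⇒Succ e)
  Adj⇒CycleAdj (inj₂ e) = inj₂ (≡⊕𝟙⇒Succ e)

  ⊕𝟙-asymmetric : ∀ {i j} → j ≡ i ⊕ 𝟙 → i ≢ j ⊕ 𝟙
  ⊕𝟙-asymmetric {i} refl i≡i⊕𝟙⊕𝟙 = x⊕𝟙⊕𝟙≢x i (sym i≡i⊕𝟙⊕𝟙)

  data Position (i j : Fin n) : Set where
    forward  : j ≡ i ⊕ 𝟙 → Position i j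
    backward : i ≡ j ⊕ 𝟙 → Position i j
    apart    : ¬ Adj i j → Position i j

  position : ∀ i j → Position i j
  position i j with j Fin.≟ i ⊕ 𝟙 | i Fin.≟ j ⊕ 𝟙
  ... | yes f | _     = forward f
  ... | no _  | yes b = backward b
  ... | no ¬f | no ¬b = apart λ { (inj₁ f) → ¬f f ; (inj₂ b) → ¬b b }

  -- Letter i of a word is the orientation of the edge {i, i ⊕ 𝟙}: true means i → i ⊕ 𝟙.
  Word : Set
  Word = Vec Bool n

  digraph : Word → Digraph n
  digraph w i j = (does (j Fin.≟ i ⊕ 𝟙) ∧ lookup w i) ∨ (does (i Fin.≟ j ⊕ 𝟙) ∧ not (lookup w j))

  word : Digraph n → Word
  word D = tabulate (λ i → D i (i ⊕ 𝟙))

  lookup-word : ∀ D i → lookup (word D) i ≡ D i (i ⊕ 𝟙)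
  lookup-word D = lookup∘tabulate (λ i → D i (i ⊕ 𝟙))

  private
    bit-or-not : ∀ {a b c : Bool} → a ≡ b → c ≡ not b → a ≡ true ⊎ c ≡ true
    bit-or-not {b = true}  refl refl = inj₁ refl
    bit-or-not {b = false} refl refl = inj₂ refl

    not-both : ∀ {a} → a ≡ true → not a ≡ true → ⊥
    not-both refl ()

    exactly-one : ∀ {a b} → a ≡ true ⊎ b ≡ true → ¬ (a ≡ true × b ≡ true) → a ≡ not b
    exactly-one {true}  {true}  _ ¬both = ⊥-elim (¬both (refl , refl))
    exactly-one {true}  {false} _ _ = refl
    exactly-one {false} {true}  _ _ = refl
    exactly-one {false} {false} (inj₁ ()) _
    exactly-one {false} {false} (inj₂ ()) _

    does-yes : ∀ {i j : Fin n} → i ≡ j → does (i Fin.≟ j) ≡ true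
    does-yes {i} {j} i≡j with i Fin.≟ j
    ... | yes _   = refl
    ... | no  i≢j = ⊥-elim (i≢j i≡j)

    does-no : ∀ {i j : Fin n} → i ≢ j → does (i Fin.≟ j) ≡ false
    does-no {i} {j} i≢j with i Fin.≟ j
    ... | yes i≡j = ⊥-elim (i≢j i≡j)
    ... | no  _   = refl

  digraph-forward : ∀ w {i j} → j ≡ i ⊕ 𝟙 → digraph w i j ≡ lookup w i
  digraph-forward w {i} {j} f rewrite does-yes f | does-no (⊕𝟙-asymmetric f) = ∨-identityʳ _

  digraph-backward : ∀ w {i j} → i ≡ j ⊕ 𝟙 → digraph w i j ≡ not (lookup w j)
  digraph-backward w {i} {j} b rewrite does-yes b | does-no (⊕𝟙-asymmetric b) = refl

  digraph-apart : ∀ w {i j} → ¬ Adj i j → digraph w i j ≡ false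
  digraph-apart w {i} {j} ¬adj rewrite does-no (¬adj ∘ inj₁) | does-no (¬adj ∘ inj₂) = refl

  digraph-oriented : ∀ w → Oriented (digraph w)
  digraph-oriented w i j (ij , ji) with position i j
  ... | forward f  = not-both (trans (sym (digraph-forward w f)) ij) (trans (sym (digraph-backward w f)) ji)
  ... | backward b = not-both (trans (sym (digraph-forward w b)) ji) (trans (sym (digraph-backward w b)) ij)
  ... | apart ¬adj with () ← trans (sym (digraph-apart w ¬adj)) ij

  digraph-underlying : ∀ w → UnderlyingIsCycle n (digraph w)
  digraph-underlying w i j = arrow⇒adjacent , adjacent⇒arrow
    where
    arrow⇒adjacent : digraph w i j ≡ true ⊎ digraph w j i ≡ true → CycleAdj n i j
    arrow⇒adjacent arrow with position i j
    ... | forward f  = Adj⇒CycleAdj (inj₁ f)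
    ... | backward b = Adj⇒CycleAdj (inj₂ b)
    ... | apart ¬adj with arrow
    ...   | inj₁ ij with () ← trans (sym (digraph-apart w ¬adj)) ij
    ...   | inj₂ ji with () ← trans (sym (digraph-apart w (¬adj ∘ swap))) ji
    adjacent⇒arrow : CycleAdj n i j → digraph w i j ≡ true ⊎ digraph w j i ≡ true
    adjacent⇒arrow adj with CycleAdj⇒Adj adj
    ... | inj₁ f = bit-or-not (digraph-forward w f) (digraph-backward w f)
    ... | inj₂ b = swap (bit-or-not (digraph-forward w b) (digraph-backward w b))

  cycleDigraph : Word → CycleDigraph n
  cycleDigraph w = digraph w , digraph-oriented w , digraph-underlying w

  word-digraph : ∀ w → word (digraph w) ≡ w
  word-digraph w = Pointwise-≡⇒≡ (ext λ i → trans (lookup-word (digraph w) i) (digraph-forward w refl))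

  digraph-word : ∀ (C : CycleDigraph n) i j → digraph (word (proj₁ C)) i j ≡ proj₁ C i j
  digraph-word (D , oriented , underlying) i j with position i j
  ... | forward f  = begin
    digraph (word D) i j  ≡⟨ digraph-forward (word D) f ⟩
    lookup (word D) i     ≡⟨ lookup-word D i ⟩
    D i (i ⊕ 𝟙)           ≡⟨ cong (D i) f ⟨
    D i j                 ∎
  ... | backward b = begin
    digraph (word D) i j  ≡⟨ digraph-backward (word D) b ⟩
    not (lookup (word D) j) ≡⟨ cong not (lookup-word D j) ⟩
    not (D j (j ⊕ 𝟙))     ≡⟨ cong (λ k → not (D j k)) b ⟨
    not (D j i)           ≡⟨ exactly-one (proj₂ (underlying i j) (Adj⇒CycleAdj (inj₂ b))) (oriented i j) ⟨
    D i j                 ∎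
  ... | apart ¬adj = trans (digraph-apart (word D) ¬adj)
                           (sym (¬-not (λ ij → ¬adj (CycleAdj⇒Adj (proj₁ (underlying i j) (inj₁ ij))))))

module DihedralAction (n : ℕ) ⦃ _ : NonZero n ⦄ (3≤n : 3 ≤ n) where
  open Cyclic n
  open Dihedral n
  open CycleDigraphs n 3≤n
  open IsGroup ·-isGroup using (inverseˡ; inverseʳ)
  open GroupProperties ·-group using (⁻¹-anti-homo-∙; ε⁻¹≈ε)
  open AbelianGroupProperties ⊕-abelianGroup using (∙-cancelʳ; //-rightDividesʳ)

  φ-inverseˡ : ∀ g x → φ (g ⁻¹) (φ g x) ≡ x
  φ-inverseˡ g x = trans (sym (φ-· (g ⁻¹) g x)) (trans (cong (λ h → φ h x) (inverseˡ g)) (φ-ε x))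

  φ-inverseʳ : ∀ g x → φ g (φ (g ⁻¹) x) ≡ x
  φ-inverseʳ g x = trans (sym (φ-· g (g ⁻¹) x)) (trans (cong (λ h → φ h x) (inverseʳ g)) (φ-ε x))

  φ-𝟘 : ∀ g → φ g 𝟘 ≡ proj₂ g
  φ-𝟘 (s , a) = trans (cong (_⊕ a) (⊖^-𝟘 s)) (⊕-identityˡ a)

  φ-⊕ : ∀ g x y → φ g (x ⊕ y) ≡ φ g x ⊕ (⊖^ proj₁ g) y
  φ-⊕ (s , a) x y = begin
    (⊖^ s) (x ⊕ y) ⊕ a              ≡⟨ cong (_⊕ a) (⊖^-⊕ s x y) ⟩
    (⊖^ s) x ⊕ (⊖^ s) y ⊕ a         ≡⟨ ⊕-assoc _ _ a ⟩
    (⊖^ s) x ⊕ ((⊖^ s) y ⊕ a)       ≡⟨ cong ((⊖^ s) x ⊕_) (⊕-comm _ a) ⟩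
    (⊖^ s) x ⊕ (a ⊕ (⊖^ s) y)       ≡⟨ ⊕-assoc _ a _ ⟨
    (⊖^ s) x ⊕ a ⊕ (⊖^ s) y         ∎

  φ-rot-⊕𝟙 : ∀ a i → φ (false , a) (i ⊕ 𝟙) ≡ φ (false , a) i ⊕ 𝟙
  φ-rot-⊕𝟙 a i = φ-⊕ (false , a) i 𝟙

  φ-ref-⊕𝟙 : ∀ a i → φ (true , a) i ≡ φ (true , a) (i ⊕ 𝟙) ⊕ 𝟙
  φ-ref-⊕𝟙 a i = begin
    φ g i                   ≡⟨ ⊕-identityʳ (φ g i) ⟨
    φ g i ⊕ 𝟘               ≡⟨ cong (φ g i ⊕_) (⊖-inverseˡ 𝟙) ⟨
    φ g i ⊕ (⊖ 𝟙 ⊕ 𝟙)       ≡⟨ ⊕-assoc _ _ 𝟙 ⟨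
    φ g i ⊕ ⊖ 𝟙 ⊕ 𝟙         ≡⟨ cong (_⊕ 𝟙) (φ-⊕ g i 𝟙) ⟨
    φ g (i ⊕ 𝟙) ⊕ 𝟙         ∎
    where g = true , a

  φ-successor : ∀ g i → Adj (φ g i) (φ g (i ⊕ 𝟙))
  φ-successor (false , a) i = inj₁ (φ-rot-⊕𝟙 a i)
  φ-successor (true  , a) i = inj₂ (φ-ref-⊕𝟙 a i)

  φ-Adj : ∀ g {i j} → Adj i j → Adj (φ g i) (φ g j)
  φ-Adj g (inj₁ refl) = φ-successor g _
  φ-Adj g (inj₂ refl) = swap (φ-successor g _)

  φ-Adj⁻ : ∀ g {i j} → Adj (φ g i) (φ g j) → Adj i j
  φ-Adj⁻ g {i} {j} adj = subst₂ Adj (φ-inverseˡ g i) (φ-inverseˡ g j) (φ-Adj (g ⁻¹) adj)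

  relabel : D → Digraph n → Digraph n
  relabel g E i j = E (φ g i) (φ g j)

  relabel-cycleDigraph : D → CycleDigraph n → CycleDigraph n
  relabel-cycleDigraph g (E , oriented , underlying) =
    relabel g E , (λ i j → oriented (φ g i) (φ g j)) , λ i j →
      (λ arrow → Adj⇒CycleAdj (φ-Adj⁻ g (CycleAdj⇒Adj (proj₁ (underlying (φ g i) (φ g j)) arrow))))
    , (λ adj → proj₂ (underlying (φ g i) (φ g j)) (Adj⇒CycleAdj (φ-Adj g (CycleAdj⇒Adj adj))))

  act : D → Word → Word
  act g w = word (relabel (g ⁻¹) (digraph w))

  digraph-act : ∀ g w i j → digraph (act g w) i j ≡ digraph w (φ (g ⁻¹) i) (φ (g ⁻¹) j)
  digraph-act g w = digraph-word (relabel-cycleDigraph (g ⁻¹) (cycleDigraph w))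

  act-ε : ∀ w → act ε w ≡ w
  act-ε w = trans (tabulate-cong λ i → cong₂ (digraph w) (φ-ε⁻¹ i) (φ-ε⁻¹ (i ⊕ 𝟙))) (word-digraph w)
    where
    φ-ε⁻¹ : ∀ x → φ (ε ⁻¹) x ≡ x
    φ-ε⁻¹ x = trans (cong (λ k → φ k x) ε⁻¹≈ε) (φ-ε x)

  lookup-act-rot : ∀ a w k → lookup (act (false , a) w) k ≡ lookup w (k ⊕ ⊖ a)
  lookup-act-rot a w k =
    trans (lookup-word (relabel (false , ⊖ a) (digraph w)) k) (digraph-forward w (φ-rot-⊕𝟙 (⊖ a) k))

  lookup-act-ref : ∀ a w k → lookup (act (true , a) w) k ≡ not (lookup w (φ (true , a) (k ⊕ 𝟙)))
  lookup-act-ref a w k =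
    trans (lookup-word (relabel (true , a) (digraph w)) k) (digraph-backward w (φ-ref-⊕𝟙 a k))

  φ-⁻¹-· : ∀ g h x → φ ((g · h) ⁻¹) x ≡ φ (h ⁻¹) (φ (g ⁻¹) x)
  φ-⁻¹-· g h x = trans (cong (λ k → φ k x) (⁻¹-anti-homo-∙ g h)) (φ-· (h ⁻¹) (g ⁻¹) x)

  act-· : ∀ g h w → act (g · h) w ≡ act g (act h w)
  act-· g h w = tabulate-cong λ i → begin
    digraph w (φ ((g · h) ⁻¹) i) (φ ((g · h) ⁻¹) (i ⊕ 𝟙))
      ≡⟨ cong₂ (digraph w) (φ-⁻¹-· g h i) (φ-⁻¹-· g h (i ⊕ 𝟙)) ⟩
    digraph w (φ (h ⁻¹) (φ (g ⁻¹) i)) (φ (h ⁻¹) (φ (g ⁻¹) (i ⊕ 𝟙)))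
      ≡⟨ digraph-act h w _ _ ⟨
    digraph (act h w) (φ (g ⁻¹) i) (φ (g ⁻¹) (i ⊕ 𝟙)) ∎

  digraph≅digraph-act : ∀ g w → digraph w ≅ digraph (act g w)
  digraph≅digraph-act g w = mk↔ₛ′ (φ g) (φ (g ⁻¹)) (φ-inverseʳ g) (φ-inverseˡ g) , λ i j →
    sym (trans (digraph-act g w (φ g i) (φ g j)) (cong₂ (digraph w) (φ-inverseˡ g i) (φ-inverseˡ g j)))

  at-most-two-neighbours : ∀ {u p q r} → Adj u p → Adj u q → Adj u r → p ≢ r → q ≢ r → p ≡ q
  at-most-two-neighbours p~ q~ r~ p≢r q≢r with p~ | q~ | r~
  ... | inj₁ p≡ | inj₁ q≡ | _       = trans p≡ (sym q≡)
  ... | inj₂ ≡p | inj₂ ≡q | _       = ∙-cancelʳ _ _ _ (trans (sym ≡p) ≡q)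
  ... | inj₁ p≡ | inj₂ _  | inj₁ r≡ = ⊥-elim (p≢r (trans p≡ (sym r≡)))
  ... | inj₁ _  | inj₂ ≡q | inj₂ ≡r = ⊥-elim (q≢r (∙-cancelʳ _ _ _ (trans (sym ≡q) ≡r)))
  ... | inj₂ ≡p | inj₁ _  | inj₂ ≡r = ⊥-elim (p≢r (∙-cancelʳ _ _ _ (trans (sym ≡p) ≡r)))
  ... | inj₂ _  | inj₁ q≡ | inj₁ r≡ = ⊥-elim (q≢r (trans q≡ (sym r≡)))

  module _ (σ τ : Fin n → Fin n)
           (σ-injective : Injective _≡_ _≡_ σ) (τ-injective : Injective _≡_ _≡_ τ)
           (σ-Adj : ∀ {i j} → Adj i j → Adj (σ i) (σ j)) (τ-Adj : ∀ {i j} → Adj i j → Adj (τ i) (τ j))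
           where

    private
      successor : ∀ x → Adj x (x ⊕ 𝟙)
      successor x = inj₁ refl

      predecessor : ∀ x → Adj (x ⊕ 𝟙) x
      predecessor x = inj₂ refl

      transport : ∀ {x y} → x ≡ y → σ x ≡ τ x → σ y ≡ τ y
      transport = subst (λ y → σ y ≡ τ y)

      agree-step : ∀ x → σ x ≡ τ x → σ (x ⊕ 𝟙) ≡ τ (x ⊕ 𝟙) → σ (x ⊕ 𝟙 ⊕ 𝟙) ≡ τ (x ⊕ 𝟙 ⊕ 𝟙)
      agree-step x σx≡τx σx⊕𝟙≡τx⊕𝟙 = at-most-two-neighbours
        (subst (λ u → Adj u (σ (x ⊕ 𝟙 ⊕ 𝟙))) σx⊕𝟙≡τx⊕𝟙 (σ-Adj (successor (x ⊕ 𝟙))))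
        (τ-Adj (successor (x ⊕ 𝟙)))
        (τ-Adj (predecessor x))
        (λ eq → x⊕𝟙⊕𝟙≢x x (σ-injective (trans eq (sym σx≡τx))))
        (λ eq → x⊕𝟙⊕𝟙≢x x (τ-injective eq))

      agree-[] : σ 𝟘 ≡ τ 𝟘 → σ 𝟙 ≡ τ 𝟙 → ∀ k → σ [ k ] ≡ τ [ k ] × σ [ suc k ] ≡ τ [ suc k ]
      agree-[] σ𝟘≡τ𝟘 σ𝟙≡τ𝟙 zero = σ𝟘≡τ𝟘 , σ𝟙≡τ𝟙
      agree-[] σ𝟘≡τ𝟘 σ𝟙≡τ𝟙 (suc k) with σk≡τk , σk+1≡τk+1 ← agree-[] σ𝟘≡τ𝟘 σ𝟙≡τ𝟙 k =
        σk+1≡τk+1 ,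
        transport (trans (cong (_⊕ 𝟙) ([]-suc k)) ([]-suc (suc k)))
                  (agree-step [ k ] σk≡τk (transport (sym ([]-suc k)) σk+1≡τk+1))

    agree-on-𝟘𝟙⇒agree : σ 𝟘 ≡ τ 𝟘 → σ 𝟙 ≡ τ 𝟙 → ∀ x → σ x ≡ τ x
    agree-on-𝟘𝟙⇒agree σ𝟘≡τ𝟘 σ𝟙≡τ𝟙 x =
      transport ([toℕ] x) (proj₁ (agree-[] σ𝟘≡τ𝟘 σ𝟙≡τ𝟙 (toℕ x)))

  φ-injective : ∀ g → Injective _≡_ _≡_ (φ g)
  φ-injective g {x} {y} eq = trans (sym (φ-inverseˡ g x)) (trans (cong (φ (g ⁻¹)) eq) (φ-inverseˡ g y))

  Adj-preserving⇒dihedral : (τ : Fin n → Fin n) → Injective _≡_ _≡_ τ →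
                            (∀ {i j} → Adj i j → Adj (τ i) (τ j)) → Σ D (λ g → ∀ x → φ g x ≡ τ x)
  Adj-preserving⇒dihedral τ τ-injective τ-Adj with τ-Adj (inj₁ (sym (⊕-identityˡ 𝟙)))
  ... | inj₁ τ𝟙≡τ𝟘⊕𝟙 = g , agree-on-𝟘𝟙⇒agree (φ g) τ (φ-injective g) τ-injective (φ-Adj g) τ-Adj
                              (φ-𝟘 g) (trans (⊕-comm 𝟙 (τ 𝟘)) (sym τ𝟙≡τ𝟘⊕𝟙))
    where g = false , τ 𝟘
  ... | inj₂ τ𝟘≡τ𝟙⊕𝟙 = g , agree-on-𝟘𝟙⇒agree (φ g) τ (φ-injective g) τ-injective (φ-Adj g) τ-Adj
                              (φ-𝟘 g) (begin
      ⊖ 𝟙 ⊕ τ 𝟘           ≡⟨ ⊕-comm (⊖ 𝟙) (τ 𝟘) ⟩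
      τ 𝟘 ⊕ ⊖ 𝟙           ≡⟨ cong (_⊕ ⊖ 𝟙) τ𝟘≡τ𝟙⊕𝟙 ⟩
      τ 𝟙 ⊕ 𝟙 ⊕ ⊖ 𝟙       ≡⟨ //-rightDividesʳ 𝟙 (τ 𝟙) ⟩
      τ 𝟙                 ∎)
    where g = true , τ 𝟘

  cycleDigraph-iso⇒act : (C E : CycleDigraph n) → proj₁ C ≅ proj₁ E →
                         Σ D (λ g → word (proj₁ E) ≡ act g (word (proj₁ C)))
  cycleDigraph-iso⇒act (C , C-oriented , C-underlying) (E , E-oriented , E-underlying) (σ , C≡E∘σ) =
    g , tabulate-cong λ i → sym (begin
      digraph (word C) (φ (g ⁻¹) i) (φ (g ⁻¹) (i ⊕ 𝟙))  ≡⟨ digraph-word (C , C-oriented , C-underlying) _ _ ⟩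
      C (φ (g ⁻¹) i) (φ (g ⁻¹) (i ⊕ 𝟙))                ≡⟨ C≡E∘σ _ _ ⟩
      E (τ (φ (g ⁻¹) i)) (τ (φ (g ⁻¹) (i ⊕ 𝟙)))        ≡⟨ cong₂ E (φ≡τ _) (φ≡τ _) ⟨
      E (φ g (φ (g ⁻¹) i)) (φ g (φ (g ⁻¹) (i ⊕ 𝟙)))    ≡⟨ cong₂ E (φ-inverseʳ g i) (φ-inverseʳ g (i ⊕ 𝟙)) ⟩
      E i (i ⊕ 𝟙)                                       ∎)
    where
    τ = Inverse.to σ
    τ-Adj : ∀ {i j} → Adj i j → Adj (τ i) (τ j)
    τ-Adj {i} {j} adj = CycleAdj⇒Adj (proj₁ (E-underlying (τ i) (τ j))
      (Data.Sum.map (trans (sym (C≡E∘σ i j))) (trans (sym (C≡E∘σ j i)))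
                    (proj₂ (C-underlying i j) (Adj⇒CycleAdj adj))))
    dihedral = Adj-preserving⇒dihedral τ (Injection.injective (↔⇒↣ σ)) τ-Adj
    g = proj₁ dihedral
    φ≡τ : ∀ x → φ g x ≡ τ x
    φ≡τ = proj₂ dihedral

module FixedWords (n : ℕ) ⦃ _ : NonZero n ⦄ (3≤n : 3 ≤ n) where
  open Cyclic n
  open Dihedral n
  open CycleDigraphs n 3≤n
  open DihedralAction n 3≤n
  open Periodic {Bool} n
  open AbelianGroupProperties ⊕-abelianGroup
    using (//-rightDividesˡ; //-rightDividesʳ; \\-leftDividesʳ; ⁻¹-involutive)

  D↔Fin : D ↔ Fin (2 * n)
  D↔Fin = ↔-trans (↔-sym 2↔Bool ×-↔ ↔-refl) (↔-sym *↔×)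

  Word↔Fin : Word ↔ Fin (2 ^ n)
  Word↔Fin = Vec-↔-Fin-^ (↔-sym 2↔Bool) n

  open Burnside ·-isGroup act act-ε act-·
    (List.tabulate (Inverse.from D↔Fin))
    (λ g → subst (_∈ _) (Inverse.strictlyInverseʳ D↔Fin g) (∈-tabulate⁺ (Inverse.to D↔Fin g)))
    (toℕ ∘ Inverse.to Word↔Fin)
    (Injection.injective (↔⇒↣ Word↔Fin) ∘ toℕ-injective)
    public

  rot-fixed⇒period : ∀ a w → act (false , a) w ≡ w → HasPeriod w (toℕ a)
  rot-fixed⇒period a w fixed x = begin
    lookup w [ x + toℕ a ]                      ≡⟨ cong (λ v → lookup v [ x + toℕ a ]) fixed ⟨
    lookup (act (false , a) w) [ x + toℕ a ]    ≡⟨ lookup-act-rot a w _ ⟩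
    lookup w ([ x + toℕ a ] ⊕ ⊖ a)              ≡⟨ cong (λ y → lookup w (y ⊕ ⊖ a)) [x+a]≡[x]⊕a ⟩
    lookup w ([ x ] ⊕ a ⊕ ⊖ a)                  ≡⟨ cong (lookup w) (//-rightDividesʳ a [ x ]) ⟩
    lookup w [ x ]                              ∎
    where
    [x+a]≡[x]⊕a : [ x + toℕ a ] ≡ [ x ] ⊕ a
    [x+a]≡[x]⊕a = trans (sym ([]-⊕-homo x (toℕ a))) (cong ([ x ] ⊕_) ([toℕ] a))

  rot-period⇒fixed : ∀ a w → HasPeriod w (toℕ a) → act (false , a) w ≡ w
  rot-period⇒fixed a w period = Pointwise-≡⇒≡ (ext λ k → begin
    lookup (act (false , a) w) k            ≡⟨ lookup-act-rot a w k ⟩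
    lookup w (k ⊕ ⊖ a)                      ≡⟨ cong (lookup w) ([toℕ] (k ⊕ ⊖ a)) ⟨
    w ! toℕ (k ⊕ ⊖ a)                       ≡⟨ period (toℕ (k ⊕ ⊖ a)) ⟨
    lookup w (k ⊕ ⊖ a ⊕ a)                  ≡⟨ cong (lookup w) (//-rightDividesˡ a k) ⟩
    lookup w k                              ∎)

  Fix-rot↔Vec : ∀ a → Fix (false , a) ↔ Vec Bool (gcd (toℕ a) n)
  Fix-rot↔Vec a = Σ-↔-retract ≡-irrelevant (restrict d∣n) (extend d∣n)
    (λ v → rot-period⇒fixed a (extend d∣n v)
             (∣-period (extend d∣n v) (extend-period d∣n v) (gcd[m,n]∣m (toℕ a) n)))
    (λ {w} fixed → extend-restrict d∣n w (gcd-period w (toℕ a) (rot-fixed⇒period a w fixed)))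
    (restrict-extend d∣n)
    where
    instance
      _ : NonZero (gcd (toℕ a) n)
      _ = ≢-nonZero (gcd[m,n]≢0 (toℕ a) n (inj₂ (≢-nonZero⁻¹ n)))
    d∣n = gcd[m,n]∣n (toℕ a) n

  Antisymmetric : Fin n → Word → Set
  Antisymmetric a w = ∀ k → lookup w k ≡ not (lookup w (φ (true , a) (k ⊕ 𝟙)))

  ref-fixed⇒antisymmetric : ∀ a w → act (true , a) w ≡ w → Antisymmetric a w
  ref-fixed⇒antisymmetric a w fixed k = trans (cong (λ v → lookup v k) (sym fixed)) (lookup-act-ref a w k)

  antisymmetric⇒ref-fixed : ∀ a w → Antisymmetric a w → act (true , a) w ≡ w
  antisymmetric⇒ref-fixed a w anti = Pointwise-≡⇒≡ (ext λ k → trans (lookup-act-ref a w k) (sym (anti k)))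

  -- The reflection maps the edge {k, k ⊕ 𝟙} to itself with the orientation reversed.
  Fix-ref↔Fin0 : ∀ a k → a ≡ k ⊕ 𝟙 ⊕ k → Fix (true , a) ↔ Fin 0
  Fix-ref↔Fin0 a k a≡k⊕𝟙⊕k = mk↔ₛ′ (λ (w , fixed) → ⊥-elim (no-fixed-word w fixed)) (λ ()) (λ ())
                                  (λ (w , fixed) → ⊥-elim (no-fixed-word w fixed))
    where
    k-is-axis : φ (true , a) (k ⊕ 𝟙) ≡ k
    k-is-axis = trans (cong (⊖ (k ⊕ 𝟙) ⊕_) a≡k⊕𝟙⊕k) (\\-leftDividesʳ (k ⊕ 𝟙) k)
    no-fixed-word : ∀ w → act (true , a) w ≡ w → ⊥
    no-fixed-word w fixed =
      not-¬ refl (trans (ref-fixed⇒antisymmetric a w fixed k) (cong (λ i → not (lookup w i)) k-is-axis))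

  ref-conjugate : ∀ t → (true , t ⊕ t) ≡ ((false , t) · (true , 𝟘)) · ((false , t) ⁻¹)
  ref-conjugate t = cong (true ,_) (cong₂ _⊕_ (sym (⊕-identityʳ t)) (sym (⁻¹-involutive t)))

  mirror : Fin n → Fin n
  mirror k = φ (true , 𝟘) (k ⊕ 𝟙)

  toℕ-mirror : ∀ k → toℕ (mirror k) ≡ n ∸ suc (toℕ k)
  toℕ-mirror k = trans (cong toℕ (⊕-identityʳ (⊖ (k ⊕ 𝟙)))) (trans (toℕ-[] _) (cases (suc (toℕ k) <? n)))
    where
    cases : Dec (suc (toℕ k) < n) → (n ∸ toℕ (k ⊕ 𝟙)) % n ≡ n ∸ suc (toℕ k)
    cases (yes k+1<n) = begin
      (n ∸ toℕ (k ⊕ 𝟙)) % n      ≡⟨ cong (λ x → (n ∸ x) % n) (trans (toℕ-⊕𝟙 k) (m<n⇒m%n≡m k+1<n)) ⟩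
      (n ∸ suc (toℕ k)) % n      ≡⟨ m<n⇒m%n≡m (∸-monoʳ-< (s≤s z≤n) (<⇒≤ k+1<n)) ⟩
      n ∸ suc (toℕ k)            ∎
    cases (no k+1≮n) = begin
      (n ∸ toℕ (k ⊕ 𝟙)) % n      ≡⟨ cong (λ x → (n ∸ x) % n) (trans (toℕ-⊕𝟙 k) (cong (_% n) k+1≡n)) ⟩
      (n ∸ n % n) % n            ≡⟨ cong (λ x → (n ∸ x) % n) (n%n≡0 n) ⟩
      n % n                      ≡⟨ n%n≡0 n ⟩
      0                          ≡⟨ n∸n≡0 n ⟨
      n ∸ n                      ≡⟨ cong (n ∸_) k+1≡n ⟨
      n ∸ suc (toℕ k)            ∎
      where
      k+1≡n : suc (toℕ k) ≡ n
      k+1≡n = ≤-antisym (toℕ<n k) (≮⇒≥ k+1≮n)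

  module EvenLength (m : ℕ) (n≡m+m : n ≡ m + m) where

    n∸[1+n∸[1+x]]≡x : ∀ {x} → x < n → n ∸ suc (n ∸ suc x) ≡ x
    n∸[1+n∸[1+x]]≡x {x} x<n = begin
      n ∸ suc (n ∸ suc x)        ≡⟨ pred[m∸n]≡m∸[1+n] n (n ∸ suc x) ⟨
      pred (n ∸ (n ∸ suc x))     ≡⟨ cong pred (m∸[m∸n]≡n x<n) ⟩
      x                          ∎

    <m⇒m≤n∸[1+x] : ∀ {x} → x < m → m ≤ n ∸ suc x
    <m⇒m≤n∸[1+x] {x} x<m = ≤-trans (≤-reflexive m≡n∸m) (∸-monoʳ-≤ n x<m)
      where
      m≡n∸m : m ≡ n ∸ m
      m≡n∸m = trans (sym (m+n∸n≡m m m)) (cong (_∸ m) (sym n≡m+m))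

    ≮m⇒n∸[1+x]<m : ∀ {x} → ¬ x < m → n ∸ suc x < m
    ≮m⇒n∸[1+x]<m {x} x≮m = ≤-<-trans (∸-monoʳ-≤ n (s≤s (≮⇒≥ x≮m)))
      (subst (λ k → k ∸ suc m < m) (sym n≡m+m) (m+m∸[1+m]<m m 0<m))
      where
      0<m : 0 < m
      0<m = m+m≢0⇒0<m m (≢-nonZero⁻¹ n ∘ trans n≡m+m)
        where
        m+m≢0⇒0<m : ∀ m → m + m ≢ 0 → 0 < m
        m+m≢0⇒0<m zero    m+m≢0 = ⊥-elim (m+m≢0 refl)
        m+m≢0⇒0<m (suc m) _     = s≤s z≤n
      m+m∸[1+m]<m : ∀ m → 0 < m → m + m ∸ suc m < m
      m+m∸[1+m]<m (suc m) _ = subst (_< suc m) (sym (m+n∸n≡m m (suc m))) ≤-refl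

    -- A word fixed by (true , 𝟘) is determined by its first m letters: letter n ∸ suc x is the
    -- complement of letter x.
    choose : Vec Bool m → ℕ → Bool
    choose v x with x <? m
    ... | yes x<m = lookup v (fromℕ< x<m)
    ... | no  x≮m = not (lookup v (fromℕ< (≮m⇒n∸[1+x]<m x≮m)))

    choose-< : ∀ v {x} (x<m : x < m) → choose v x ≡ lookup v (fromℕ< x<m)
    choose-< v {x} x<m with x <? m
    ... | yes _   = refl
    ... | no  x≮m = ⊥-elim (x≮m x<m)

    choose-≮ : ∀ v {x} (x≮m : ¬ x < m) → choose v x ≡ not (lookup v (fromℕ< (≮m⇒n∸[1+x]<m x≮m)))
    choose-≮ v {x} x≮m with x <? m
    ... | yes x<m = ⊥-elim (x≮m x<m)
    ... | no  _   = refl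

    choose-mirror : ∀ v {x} → x < n → choose v (n ∸ suc x) ≡ not (choose v x)
    choose-mirror v {x} x<n with x <? m
    ... | yes x<m = trans (choose-≮ v (≤⇒≯ (<m⇒m≤n∸[1+x] x<m)))
                          (cong (λ i → not (lookup v i)) (fromℕ<-cong _ _ (n∸[1+n∸[1+x]]≡x x<n) _ x<m))
    ... | no  x≮m = trans (choose-< v (≮m⇒n∸[1+x]<m x≮m)) (sym (not-involutive _))

    toVec : Word → Vec Bool m
    toVec w = tabulate (λ j → w ! toℕ j)

    fromVec : Vec Bool m → Word
    fromVec v = tabulate (λ k → choose v (toℕ k))

    fromVec-antisymmetric : ∀ v → Antisymmetric 𝟘 (fromVec v)
    fromVec-antisymmetric v k = begin
      lookup (fromVec v) k                  ≡⟨ lookup∘tabulate _ k ⟩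
      choose v (toℕ k)                      ≡⟨ not-involutive _ ⟨
      not (not (choose v (toℕ k)))          ≡⟨ cong not (choose-mirror v (toℕ<n k)) ⟨
      not (choose v (n ∸ suc (toℕ k)))      ≡⟨ cong (λ x → not (choose v x)) (toℕ-mirror k) ⟨
      not (choose v (toℕ (mirror k)))       ≡⟨ cong not (lookup∘tabulate _ (mirror k)) ⟨
      not (lookup (fromVec v) (mirror k))   ∎

    toVec-fromVec : ∀ v → toVec (fromVec v) ≡ v
    toVec-fromVec v = trans (tabulate-cong λ j → begin
      lookup (fromVec v) [ toℕ j ]      ≡⟨ lookup∘tabulate _ [ toℕ j ] ⟩
      choose v (toℕ [ toℕ j ])          ≡⟨ cong (choose v) (trans (toℕ-[] (toℕ j)) (m<n⇒m%n≡m (j<n j))) ⟩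
      choose v (toℕ j)                  ≡⟨ choose-< v (toℕ<n j) ⟩
      lookup v (fromℕ< (toℕ<n j))       ≡⟨ cong (lookup v) (fromℕ<-toℕ j (toℕ<n j)) ⟩
      lookup v j                        ∎) (tabulate∘lookup v)
      where
      j<n : ∀ (j : Fin m) → toℕ j < n
      j<n j = <-≤-trans (toℕ<n j) (subst (m ≤_) (sym n≡m+m) (m≤m+n m m))

    fromVec-toVec : ∀ w → Antisymmetric 𝟘 w → fromVec (toVec w) ≡ w
    fromVec-toVec w anti = Pointwise-≡⇒≡ (ext λ k → trans (lookup∘tabulate _ k) (cases k (toℕ k <? m)))
      where
      cases : ∀ k → Dec (toℕ k < m) → choose (toVec w) (toℕ k) ≡ lookup w k
      cases k (yes k<m) = begin
        choose (toVec w) (toℕ k)               ≡⟨ choose-< (toVec w) k<m ⟩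
        lookup (toVec w) (fromℕ< k<m)          ≡⟨ lookup∘tabulate _ (fromℕ< k<m) ⟩
        w ! toℕ (fromℕ< k<m)                   ≡⟨ cong (w !_) (toℕ-fromℕ< k<m) ⟩
        lookup w [ toℕ k ]                     ≡⟨ cong (lookup w) ([toℕ] k) ⟩
        lookup w k                             ∎
      cases k (no k≮m) = begin
        choose (toVec w) (toℕ k)               ≡⟨ choose-≮ (toVec w) k≮m ⟩
        not (lookup (toVec w) (fromℕ< n∸[1+k]<m)) ≡⟨ cong not (lookup∘tabulate _ (fromℕ< n∸[1+k]<m)) ⟩
        not (w ! toℕ (fromℕ< n∸[1+k]<m))       ≡⟨ cong (λ x → not (w ! x)) (toℕ-fromℕ< n∸[1+k]<m) ⟩
        not (w ! (n ∸ suc (toℕ k)))            ≡⟨ cong (λ x → not (w ! x)) (toℕ-mirror k) ⟨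
        not (lookup w [ toℕ (mirror k) ])      ≡⟨ cong (λ i → not (lookup w i)) ([toℕ] (mirror k)) ⟩
        not (lookup w (mirror k))              ≡⟨ anti k ⟨
        lookup w k                             ∎
        where
        n∸[1+k]<m = ≮m⇒n∸[1+x]<m k≮m

    Fix-ref𝟘↔Vec : Fix (true , 𝟘) ↔ Vec Bool m
    Fix-ref𝟘↔Vec = Σ-↔-retract ≡-irrelevant toVec fromVec
      (λ v → antisymmetric⇒ref-fixed 𝟘 (fromVec v) (fromVec-antisymmetric v))
      (λ {w} fixed → fromVec-toVec w (ref-fixed⇒antisymmetric 𝟘 w fixed))
      toVec-fromVec

  Fix-cong : ∀ {g h} → g ≡ h → Fix g ↔ Fix h
  Fix-cong refl = ↔-refl

  even⇒[t]⊕[t] : ∀ a t → toℕ a ≡ t + t → a ≡ [ t ] ⊕ [ t ]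
  even⇒[t]⊕[t] a t a≡t+t = trans (sym ([toℕ] a)) (trans (cong [_] a≡t+t) (sym ([]-⊕-homo t t)))

  odd⇒[t]⊕𝟙⊕[t] : ∀ a t → toℕ a ≡ suc (t + t) → a ≡ [ t ] ⊕ 𝟙 ⊕ [ t ]
  odd⇒[t]⊕𝟙⊕[t] a t a≡1+t+t = begin
    a                    ≡⟨ [toℕ] a ⟨
    [ toℕ a ]            ≡⟨ cong [_] a≡1+t+t ⟩
    [ suc t + t ]        ≡⟨ []-⊕-homo (suc t) t ⟨
    [ suc t ] ⊕ [ t ]    ≡⟨ cong (_⊕ [ t ]) ([]-suc t) ⟨
    [ t ] ⊕ 𝟙 ⊕ [ t ]    ∎

  Fix-ref↔Fin-even : ∀ m → n ≡ m + m → ∀ a → Fix (true , a) ↔ Fin (onEven (2 ^ m) (toℕ a))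
  Fix-ref↔Fin-even m n≡m+m a with even-or-odd (toℕ a)
  ... | inj₁ (t , a≡t+t) = subst (λ k → Fix (true , a) ↔ Fin k)
    (sym (trans (cong (onEven (2 ^ m)) a≡t+t) (onEven-even (2 ^ m) t)))
    (↔-trans (Fix-cong (trans (cong (true ,_) (even⇒[t]⊕[t] a t a≡t+t)) (ref-conjugate [ t ])))
    (↔-trans (Fix-conjugate (true , 𝟘) (false , [ t ]))
    (↔-trans (EvenLength.Fix-ref𝟘↔Vec m n≡m+m)
             (Vec-↔-Fin-^ (↔-sym 2↔Bool) m))))
  ... | inj₂ (t , a≡1+t+t) = subst (λ k → Fix (true , a) ↔ Fin k)
    (sym (trans (cong (onEven (2 ^ m)) a≡1+t+t) (onEven-odd (2 ^ m) t)))
    (Fix-ref↔Fin0 a [ t ] (odd⇒[t]⊕𝟙⊕[t] a t a≡1+t+t))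

  Fix-ref↔Fin0-odd : ∀ m → n ≡ suc (m + m) → ∀ a → Fix (true , a) ↔ Fin 0
  Fix-ref↔Fin0-odd m n≡1+m+m a with even-or-odd (toℕ a)
  ... | inj₂ (t , a≡1+t+t) = Fix-ref↔Fin0 a [ t ] (odd⇒[t]⊕𝟙⊕[t] a t a≡1+t+t)
  ... | inj₁ (t , a≡t+t) = Fix-ref↔Fin0 a [ t + m ] (begin
    a                                  ≡⟨ [toℕ] a ⟨
    [ toℕ a ]                          ≡⟨ cong [_] a≡t+t ⟩
    [ t + t ]                          ≡⟨ []-cong-% ([m+n]%n≡m%n (t + t) n) ⟨
    [ t + t + n ]                      ≡⟨ cong (λ k → [ t + t + k ]) n≡1+m+m ⟩
    [ t + t + suc (m + m) ]            ≡⟨ cong [_] (rearrange t m) ⟩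
    [ suc (t + m) + (t + m) ]          ≡⟨ []-⊕-homo (suc (t + m)) (t + m) ⟨
    [ suc (t + m) ] ⊕ [ t + m ]        ≡⟨ cong (_⊕ [ t + m ]) ([]-suc (t + m)) ⟨
    [ t + m ] ⊕ 𝟙 ⊕ [ t + m ]          ∎)
    where
    rearrange : ∀ t m → t + t + suc (m + m) ≡ suc (t + m) + (t + m)
    rearrange = solve-∀

  opaque
    orbits : ℕ
    orbits = sum (λ i → indicator (canon (Inverse.from Word↔Fin i) ≟ Inverse.from Word↔Fin i))

    Canonical↔Fin : Σ Word Canonical ↔ Fin orbits
    Canonical↔Fin = Σ-Dec-↔-Fin Word↔Fin ≡-irrelevant (λ w → canon w ≟ w)

  FixedByRotations FixedByReflections : Set
  FixedByRotations   = Σ (Fin n) (λ a → Fix (false , a))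
  FixedByReflections = Σ (Fin n) (λ a → Fix (true , a))

  Fix↔rotations⊎reflections : Σ D Fix ↔ (FixedByRotations ⊎ FixedByReflections)
  Fix↔rotations⊎reflections = ↔-trans Σ-assoc (mk↔ₛ′
    (λ { (false , p) → inj₁ p ; (true , p) → inj₂ p })
    (λ { (inj₁ p) → false , p ; (inj₂ p) → true , p })
    (λ { (inj₁ p) → refl ; (inj₂ p) → refl })
    (λ { (false , p) → refl ; (true , p) → refl }))

  FixedByRotations↔Fin : FixedByRotations ↔ Fin (∑[ a < n ] (2 ^ gcd (toℕ a) n))
  FixedByRotations↔Fin = Σ-Fin-↔-sum {n} (λ a → 2 ^ gcd (toℕ a) n) λ a →
    ↔-trans (Fix-rot↔Vec a) (Vec-↔-Fin-^ (↔-sym 2↔Bool) (gcd (toℕ a) n))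

  FixedByReflections↔Fin-odd : ∀ m → n ≡ suc (m * 2) → FixedByReflections ↔ Fin 0
  FixedByReflections↔Fin-odd m n≡1+m*2 = subst (λ k → FixedByReflections ↔ Fin k) (sum-replicate-zero n)
    (Σ-Fin-↔-sum {n} (λ _ → 0) (Fix-ref↔Fin0-odd m (trans n≡1+m*2 (cong suc (m*2≡m+m m)))))

  FixedByReflections↔Fin-even : ∀ m → n ≡ m * 2 → FixedByReflections ↔ Fin (m * 2 ^ m)
  FixedByReflections↔Fin-even m n≡m*2 = subst (λ k → FixedByReflections ↔ Fin k)
    (trans (cong (λ k → sum {k} (λ a → onEven (2 ^ m) (toℕ a))) n≡m*2) (sum-onEven (2 ^ m) m))
    (Σ-Fin-↔-sum {n} (λ a → onEven (2 ^ m) (toℕ a)) (Fix-ref↔Fin-even m (trans n≡m*2 (m*2≡m+m m))))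

  burnside-dihedral : ∀ {r} → FixedByReflections ↔ Fin r → 2 * n * orbits ≡ ∑[ a < n ] (2 ^ gcd (toℕ a) n) + r
  burnside-dihedral {r} reflections = burnside D↔Fin Canonical↔Fin
    (↔-trans Fix↔rotations⊎reflections (↔-trans (FixedByRotations↔Fin ⊎-↔ reflections)
                                                 (↔-sym (+↔⊎ {∑[ a < n ] (2 ^ gcd (toℕ a) n)} {r}))))

-- Sums over divisors

totient-∑ : ∀ d → totient d ≡ ∑[ j < d ] indicator (gcd (toℕ j) d ℕ.≟ 1)
totient-∑ zero       = refl
totient-∑ d@(suc d′) = begin
  totient d
    ≡⟨ length-filter-map-applyUpTo (λ k → gcd k d ℕ.≟ 1) suc id d ⟩
  ∑[ k < d ] coprime (suc (toℕ k))
    ≡⟨ sum-init-last {d′} (λ k → coprime (suc (toℕ k))) ⟩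
  ∑[ k < d′ ] coprime (suc (toℕ (inject₁ k))) + coprime (suc (toℕ (fromℕ d′)))
    ≡⟨ cong₂ _+_ (sum-cong-≗ {d′} λ k → cong (coprime ∘ suc) (toℕ-inject₁ k))
                 (cong (coprime ∘ suc) (toℕ-fromℕ d′)) ⟩
  ∑[ k < d′ ] coprime (suc (toℕ k)) + coprime d
    ≡⟨ +-comm _ (coprime d) ⟩
  coprime d + ∑[ k < d′ ] coprime (suc (toℕ k))
    ≡⟨ cong (λ x → indicator (x ℕ.≟ 1) + ∑[ k < d′ ] coprime (suc (toℕ k))) gcd[d,d]≡gcd[0,d] ⟩
  ∑[ j < d ] coprime (toℕ j)
    ∎
  where
  coprime : ℕ → ℕ
  coprime k = indicator (gcd k d ℕ.≟ 1)
  gcd[d,d]≡gcd[0,d] : gcd d d ≡ gcd 0 d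
  gcd[d,d]≡gcd[0,d] = ∣-antisym (gcd[m,n]∣m d d) (gcd-greatest ∣-refl ∣-refl)

module _ {n d : ℕ} ⦃ _ : NonZero n ⦄ ⦃ _ : NonZero d ⦄ (d∣n : d ∣ n) where

  private
    g : ℕ
    g = n / d

    n≡g*d : n ≡ g * d
    n≡g*d = trans (sym (m*[n/m]≡n d∣n)) (*-comm d g)

    instance
      _ : NonZero g
      _ = ≢-nonZero λ g≡0 → ≢-nonZero⁻¹ n (trans n≡g*d (cong (_* d) g≡0))

    g*j<n : ∀ (j : Fin d) → g * toℕ j < n
    g*j<n j = subst (g * toℕ j <_) (sym n≡g*d) (*-monoʳ-< g (toℕ<n j))

    x/g<d : ∀ (x : Fin n) → toℕ x / g < d
    x/g<d x = m<n*o⇒m/o<n (subst (toℕ x <_) (trans n≡g*d (*-comm g d)) (toℕ<n x))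

    gcd-scale : ∀ y → gcd (g * y) n ≡ g * gcd y d
    gcd-scale y = trans (cong (gcd (g * y)) n≡g*d) (sym (c*gcd[m,n]≡gcd[cm,cn] g y d))

    g∣x : ∀ x → gcd x n ≡ g → g ∣ x
    g∣x x gcd≡g = subst (_∣ x) gcd≡g (gcd[m,n]∣m x n)

  coprime↔gcd≡n/d : Σ (Fin d) (λ j → gcd (toℕ j) d ≡ 1) ↔ Σ (Fin n) (λ x → gcd (toℕ x) n ≡ n / d)
  coprime↔gcd≡n/d = Σ-↔-restrict ℕ.≡-irrelevant ℕ.≡-irrelevant
    (λ j → fromℕ< (g*j<n j)) (λ x → fromℕ< (x/g<d x))
    (λ {j} coprime → begin
      gcd (toℕ (fromℕ< (g*j<n j))) n  ≡⟨ cong (λ y → gcd y n) (toℕ-fromℕ< (g*j<n j)) ⟩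
      gcd (g * toℕ j) n               ≡⟨ gcd-scale (toℕ j) ⟩
      g * gcd (toℕ j) d               ≡⟨ cong (g *_) coprime ⟩
      g * 1                           ≡⟨ *-identityʳ g ⟩
      g                               ∎)
    (λ {x} gcd≡g → *-cancelˡ-≡ _ 1 g (begin
      g * gcd (toℕ (fromℕ< (x/g<d x))) d   ≡⟨ cong (λ y → g * gcd y d) (toℕ-fromℕ< (x/g<d x)) ⟩
      g * gcd (toℕ x / g) d               ≡⟨ gcd-scale (toℕ x / g) ⟨
      gcd (g * (toℕ x / g)) n             ≡⟨ cong (λ y → gcd y n) (m*[n/m]≡n (g∣x (toℕ x) gcd≡g)) ⟩
      gcd (toℕ x) n                       ≡⟨ gcd≡g ⟩
      g                                   ≡⟨ *-identityʳ g ⟨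
      g * 1                               ∎))
    (λ {j} _ → toℕ-injective (begin
      toℕ (fromℕ< (x/g<d (fromℕ< (g*j<n j))))  ≡⟨ toℕ-fromℕ< _ ⟩
      toℕ (fromℕ< (g*j<n j)) / g               ≡⟨ cong (_/ g) (toℕ-fromℕ< (g*j<n j)) ⟩
      g * toℕ j / g                            ≡⟨ cong (_/ g) (*-comm g (toℕ j)) ⟩
      toℕ j * g / g                            ≡⟨ m*n/n≡m (toℕ j) g ⟩
      toℕ j                                    ∎))
    (λ {x} gcd≡g → toℕ-injective (begin
      toℕ (fromℕ< (g*j<n (fromℕ< (x/g<d x))))  ≡⟨ toℕ-fromℕ< _ ⟩
      g * toℕ (fromℕ< (x/g<d x))               ≡⟨ cong (g *_) (toℕ-fromℕ< (x/g<d x)) ⟩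
      g * (toℕ x / g)                          ≡⟨ m*[n/m]≡n (g∣x (toℕ x) gcd≡g) ⟩
      toℕ x                                    ∎))

  count-gcd≡n/d : ∑[ x < n ] indicator (gcd (toℕ x) n ℕ.≟ n / d) ≡ ∑[ j < d ] indicator (gcd (toℕ j) d ℕ.≟ 1)
  count-gcd≡n/d = ↔Fin-injective
    (Σ-Dec-↔-Fin ↔-refl ℕ.≡-irrelevant (λ x → gcd (toℕ x) n ℕ.≟ n / d))
    (↔-trans (↔-sym coprime↔gcd≡n/d) (Σ-Dec-↔-Fin ↔-refl ℕ.≡-irrelevant (λ j → gcd (toℕ j) d ℕ.≟ 1)))

module _ (n : ℕ) ⦃ _ : NonZero n ⦄ (f : ℕ → ℕ) where

  -- Expand totient (suc k) as the number of x < n with gcd x n ≡ n / suc k, swap the two sums, and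
  -- observe that for each x only suc k ≡ n / gcd x n contributes.
  private
    divisorTerm : ∀ {k} → Dec (suc k ∣ n) → ℕ
    divisorTerm {k} (yes _) = f (n / suc k) * totient (suc k)
    divisorTerm     (no _)  = 0

    term : ∀ {k} → Dec (suc k ∣ n) → ℕ → ℕ
    term {k} (yes _) x = f (n / suc k) * indicator (gcd x n ℕ.≟ n / suc k)
    term     (no _)  x = 0

    divisorTerm-if : ∀ {k} (D : Dec (suc k ∣ n)) →
                     (if does D then f (n / suc k) * totient (suc k) else 0) ≡ divisorTerm D
    divisorTerm-if (yes _) = refl
    divisorTerm-if (no _)  = refl

    divisorTerm-∑ : ∀ {k} (D : Dec (suc k ∣ n)) → divisorTerm D ≡ ∑[ x < n ] term D (toℕ x)
    divisorTerm-∑ {k} (yes d∣n) = begin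
      f (n / suc k) * totient (suc k)
        ≡⟨ cong (f (n / suc k) *_) (trans (totient-∑ (suc k)) (sym (count-gcd≡n/d d∣n))) ⟩
      f (n / suc k) * ∑[ x < n ] indicator (gcd (toℕ x) n ℕ.≟ n / suc k)
        ≡⟨ *-distribˡ-sum {n} (f (n / suc k)) (λ x → indicator (gcd (toℕ x) n ℕ.≟ n / suc k)) ⟩
      ∑[ x < n ] (f (n / suc k) * indicator (gcd (toℕ x) n ℕ.≟ n / suc k)) ∎
    divisorTerm-∑ (no _) = sym (sum-replicate-zero n)

    module _ (x : ℕ) where
      G : ℕ
      G = gcd x n

      instance
        G-nonZero : NonZero G
        G-nonZero = ≢-nonZero (gcd[m,n]≢0 x n (inj₂ (≢-nonZero⁻¹ n)))

      q : ℕ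
      q = n / G

      n≡G*q : n ≡ G * q
      n≡G*q = sym (m*[n/m]≡n (gcd[m,n]∣n x n))

      instance
        q-nonZero : NonZero q
        q-nonZero = ≢-nonZero λ q≡0 → ≢-nonZero⁻¹ n (trans n≡G*q (trans (cong (G *_) q≡0) (*-zeroʳ G)))

      q∣n : q ∣ n
      q∣n = divides G n≡G*q

      G≡n/d⇒d≡q : ∀ {d} ⦃ _ : NonZero d ⦄ → d ∣ n → G ≡ n / d → d ≡ q
      G≡n/d⇒d≡q {d} d∣n G≡n/d = sym (begin
        n / G             ≡⟨ cong (_/ G) n≡d*G ⟩
        d * G / G         ≡⟨ m*n/n≡m d G ⟩
        d                 ∎)
        where
        n≡d*G : n ≡ d * G
        n≡d*G = trans (sym (m*[n/m]≡n d∣n)) (cong (d *_) (sym G≡n/d))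

      term-at-q : ∀ {k} (D : Dec (suc k ∣ n)) → suc k ≡ q → term D x ≡ f G
      term-at-q {k} (yes _) sk≡q = begin
        f (n / suc k) * indicator (G ℕ.≟ n / suc k)
          ≡⟨ cong (f (n / suc k) *_) (indicator-yes (G ℕ.≟ n / suc k) (sym n/sk≡G)) ⟩
        f (n / suc k) * 1   ≡⟨ *-identityʳ _ ⟩
        f (n / suc k)       ≡⟨ cong f n/sk≡G ⟩
        f G                 ∎
        where
        n/sk≡G : n / suc k ≡ G
        n/sk≡G = trans (cong (_/ suc k) (trans n≡G*q (cong (G *_) (sym sk≡q)))) (m*n/n≡m G (suc k))
      term-at-q (no ¬sk∣n) sk≡q = ⊥-elim (¬sk∣n (subst (_∣ n) (sym sk≡q) q∣n))

      term-off-q : ∀ {k} (D : Dec (suc k ∣ n)) → suc k ≢ q → term D x ≡ 0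
      term-off-q {k} (yes d∣n) ≢q = trans
        (cong (f (n / suc k) *_) (indicator-no (G ℕ.≟ n / suc k) λ G≡n/sk → ≢q (G≡n/d⇒d≡q d∣n G≡n/sk)))
        (*-zeroʳ (f (n / suc k)))
      term-off-q (no _) _ = refl

      k₀ : Fin n
      k₀ = fromℕ< (subst (_≤ n) (sym (ℕ.suc-pred q)) (∣⇒≤ q∣n))

      ∑-term : ∑[ k < n ] term (suc (toℕ k) ∣? n) x ≡ f G
      ∑-term = trans
        (sum-vanishing-outside (λ k → term (suc (toℕ k) ∣? n) x) k₀ λ j j≢k₀ →
          term-off-q (suc (toℕ j) ∣? n) λ sj≡q →
            j≢k₀ (toℕ-injective (trans (cong pred sj≡q) (sym (toℕ-fromℕ< _)))))
        (term-at-q (suc (toℕ k₀) ∣? n) (trans (cong suc (toℕ-fromℕ< _)) (ℕ.suc-pred q)))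

  ∑-f∘gcd : ListAction.sum (map (λ k → f (n / suc k) * totient (suc k)) (filter (λ k → suc k ∣? n) (upTo n)))
          ≡ ∑[ x < n ] f (gcd (toℕ x) n)
  ∑-f∘gcd = begin
    ListAction.sum (map (λ k → f (n / suc k) * totient (suc k)) (filter (λ k → suc k ∣? n) (upTo n)))
      ≡⟨ sum-map-filter-applyUpTo (λ k → suc k ∣? n) _ id n ⟩
    ∑[ k < n ] (if does (suc (toℕ k) ∣? n) then f (n / suc (toℕ k)) * totient (suc (toℕ k)) else 0)
      ≡⟨ sum-cong-≗ {n} (λ k → trans (divisorTerm-if (suc (toℕ k) ∣? n))
                                     (divisorTerm-∑ (suc (toℕ k) ∣? n))) ⟩
    ∑[ k < n ] ∑[ x < n ] term (suc (toℕ k) ∣? n) (toℕ x)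
      ≡⟨ ∑-comm {n} {n} (λ k x → term (suc (toℕ k) ∣? n) (toℕ x)) ⟩
    ∑[ x < n ] ∑[ k < n ] term (suc (toℕ k) ∣? n) (toℕ x)
      ≡⟨ sum-cong-≗ {n} (λ x → ∑-term (toℕ x)) ⟩
    ∑[ x < n ] f (gcd (toℕ x) n) ∎

-- Isomorphism classes of orientations of C_n

≗⇒≅ : ∀ {n} {D E : Digraph n} → (∀ i j → D i j ≡ E i j) → D ≅ E
≗⇒≅ D≡E = ↔-refl , D≡E

≅-trans : ∀ {n} {D E F : Digraph n} → D ≅ E → E ≅ F → D ≅ F
≅-trans (σ , D≡E∘σ) (τ , E≡F∘τ) =
  ↔-trans σ τ , λ i j → trans (D≡E∘σ i j) (E≡F∘τ (Inverse.to σ i) (Inverse.to σ j))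

m*2^m≡2*[m*2]*2^[m∸2] : ∀ m → 3 ≤ m * 2 → m * 2 ^ m ≡ 2 * (m * 2) * 2 ^ (m ∸ 2)
m*2^m≡2*[m*2]*2^[m∸2] (suc (suc k)) _ = lemma k (2 ^ k)
  where
  lemma : ∀ k x → suc (suc k) * (2 * (2 * x)) ≡ 2 * (suc (suc k) * 2) * x
  lemma = solve-∀
m*2^m≡2*[m*2]*2^[m∸2] (suc zero) (s≤s (s≤s ()))

module Classification (n : ℕ) ⦃ _ : NonZero n ⦄ (3≤n : 3 ≤ n) where
  open CycleDigraphs n 3≤n
  open DihedralAction n 3≤n
  open FixedWords n 3≤n

  representative : Fin orbits → CycleDigraph n
  representative i = cycleDigraph (proj₁ (Inverse.from Canonical↔Fin i))

  representative-injective : ∀ a b → proj₁ (representative a) ≅ proj₁ (representative b) → a ≡ b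
  representative-injective a b iso = begin
    a                                   ≡⟨ Inverse.strictlyInverseˡ Canonical↔Fin a ⟨
    Inverse.to Canonical↔Fin (wa , ca)  ≡⟨ cong (Inverse.to Canonical↔Fin) (Σ-≡-irrelevant ≡-irrelevant wa≡wb) ⟩
    Inverse.to Canonical↔Fin (wb , cb)  ≡⟨ Inverse.strictlyInverseˡ Canonical↔Fin b ⟩
    b                                   ∎
    where
    wa = proj₁ (Inverse.from Canonical↔Fin a)
    ca = proj₂ (Inverse.from Canonical↔Fin a)
    wb = proj₁ (Inverse.from Canonical↔Fin b)
    cb = proj₂ (Inverse.from Canonical↔Fin b)
    relation = cycleDigraph-iso⇒act (representative a) (representative b) iso
    g = proj₁ relation
    wb≡g·wa : wb ≡ act g wa
    wb≡g·wa = trans (sym (word-digraph wb)) (trans (proj₂ relation) (cong (act g) (word-digraph wa)))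
    wa≡wb : wa ≡ wb
    wa≡wb = canonical-unique g ca cb wb≡g·wa

  representative-surjective : ∀ C → Σ (Fin orbits) (λ a → proj₁ C ≅ proj₁ (representative a))
  representative-surjective C =
    Inverse.to Canonical↔Fin c ,
    subst (λ c′ → proj₁ C ≅ digraph (proj₁ c′)) (sym (Inverse.strictlyInverseʳ Canonical↔Fin c)) C≅canon
    where
    w = word (proj₁ C)
    c = canon w , canon-canonical w
    C≅canon : proj₁ C ≅ digraph (canon w)
    C≅canon = ≅-trans {D = proj₁ C} {E = digraph w} {F = digraph (canon w)}
      (≗⇒≅ λ i j → sym (digraph-word C i j)) (digraph≅digraph-act (transporter w) w)

  numIsoClasses : NumIsoClasses n orbits
  numIsoClasses = representative , representative-injective , representative-surjective

  ∑2^gcd≡necklaceSum : ∑[ a < n ] (2 ^ gcd (toℕ a) n) ≡ necklaceSum n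
  ∑2^gcd≡necklaceSum = sym (∑-f∘gcd n (2 ^_))

  2n*orbits-odd : n % 2 ≡ 1 → 2 * n * orbits ≡ necklaceSum n
  2n*orbits-odd n%2≡1 = begin
    2 * n * orbits                        ≡⟨ burnside-dihedral (FixedByReflections↔Fin-odd (n / 2) n≡1+[n/2]*2) ⟩
    ∑[ a < n ] (2 ^ gcd (toℕ a) n) + 0    ≡⟨ +-identityʳ _ ⟩
    ∑[ a < n ] (2 ^ gcd (toℕ a) n)        ≡⟨ ∑2^gcd≡necklaceSum ⟩
    necklaceSum n                         ∎
    where
    n≡1+[n/2]*2 : n ≡ suc (n / 2 * 2)
    n≡1+[n/2]*2 = trans (m≡m%n+[m/n]*n n 2) (cong (_+ n / 2 * 2) n%2≡1)

  2n*orbits-even : n % 2 ≡ 0 → 2 * n * orbits ≡ necklaceSum n + 2 * n * 2 ^ (n / 2 ∸ 2)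
  2n*orbits-even n%2≡0 = begin
    2 * n * orbits
      ≡⟨ burnside-dihedral (FixedByReflections↔Fin-even (n / 2) n≡[n/2]*2) ⟩
    ∑[ a < n ] (2 ^ gcd (toℕ a) n) + n / 2 * 2 ^ (n / 2)
      ≡⟨ cong₂ _+_ ∑2^gcd≡necklaceSum (m*2^m≡2*[m*2]*2^[m∸2] (n / 2) (subst (3 ≤_) n≡[n/2]*2 3≤n)) ⟩
    necklaceSum n + 2 * (n / 2 * 2) * 2 ^ (n / 2 ∸ 2)
      ≡⟨ cong (λ k → necklaceSum n + 2 * k * 2 ^ (n / 2 ∸ 2)) n≡[n/2]*2 ⟨
    necklaceSum n + 2 * n * 2 ^ (n / 2 ∸ 2)
      ∎
    where
    n≡[n/2]*2 : n ≡ n / 2 * 2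
    n≡[n/2]*2 = trans (m≡m%n+[m/n]*n n 2) (cong (_+ n / 2 * 2) n%2≡0)

fact5p4 : (n : ℕ) → 3 ≤ n →
    ((n % 2 ≡ 1) → Σ ℕ (λ c → NumIsoClasses n c × (2 * n * c ≡ necklaceSum n)))
    × ((n % 2 ≡ 0) → Σ ℕ (λ c → NumIsoClasses n c × (2 * n * c ≡ necklaceSum n + 2 * n * 2 ^ (n / 2 ∸ 2))))
fact5p4 n@(suc _) 3≤n =
    (λ n-odd  → orbits , numIsoClasses , 2n*orbits-odd n-odd)
  , (λ n-even → orbits , numIsoClasses , 2n*orbits-even n-even)
  where
  open FixedWords n 3≤n using (orbits)
  open Classification n 3≤n
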